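{- Let $\mathcal{T}$ be a decidable theory such that $\mathcal{T}\sqcup\mathcal{T}'$ is decidable for every decidable stably infinite theory $\mathcal{T}'$. Then $\mathcal{T}$ is stably infinite.
   Context: All logic is one-sorted first-order logic with equality, and all signatures are countable. A $\Sigma$-theory is a set of $\Sigma$-sentences; a $\mathcal{T}$-interpretation is a $\Sigma$-structure (nonempty domain) with a variable assignment satisfying all axioms of $\mathcal{T}$. $\mathcal{T}$ is decidable if there is an algorithm deciding, for a quantifier-free $\Sigma$-formula, whether some $\mathcal{T}$-interpretation satisfies it. For theories $\mathcal{T}_1,\mathcal{T}_2$, the disjoint combination $\mathcal{T}_1\sqcup\mathcal{T}_2$ is the theory over the disjoint union of their signatures (renamed to share only equality) axiomatized by the union of their axioms. A theory $\mathcal{T}$ is stably infinite if every $\mathcal{T}$-satisfiable quantifier-free formula is satisfied by some $\mathcal{T}$-interpretation with infinite domain. -}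

module Defs where

open import Level using (Level; 0ℓ) renaming (suc to lsuc)
open import Data.Nat using (ℕ; zero; suc; _+_)
open import Data.Fin using (Fin)
open import Data.Vec using (Vec; []; _∷_; lookup)
open import Data.Maybe using (Maybe; just; nothing; _>>=_)
open import Data.Product using (Σ; _×_; _,_; ∃)
open import Data.Sum using (_⊎_; inj₁; inj₂)
open import Data.Empty using (⊥)
open import Data.Unit using (⊤)
open import Relation.Nullary using (¬_)
open import Relation.Binary.PropositionalEquality using (_≡_; _≢_; refl; sym; trans; subst)
open import Function.Bundles using (_↔_)

-- 1. A concrete model of computation: partial recursive (μ-recursive)
--    functions, with a fuel-indexed evaluator.  "There is an algorithm"
--    is read as "there is a partial recursive function".

data PR : ℕ → Set where
  zeroF : ∀ {n} → PR n
  succF : PR 1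
  projF : ∀ {n} → Fin n → PR n
  compF : ∀ {n m} → PR m → Vec (PR n) m → PR n
  recF  : ∀ {n} → PR n → PR (suc (suc n)) → PR (suc n)
  minF  : ∀ {n} → PR (suc n) → PR n

mutual
  -- eval k f xs : result of running f on xs with fuel k (nothing = out of fuel / diverging)
  eval : ℕ → ∀ {n} → PR n → Vec ℕ n → Maybe ℕ
  eval zero    _           _            = nothing
  eval (suc k) zeroF       _            = just 0
  eval (suc k) succF       (x ∷ [])     = just (suc x)
  eval (suc k) (projF i)   xs           = just (lookup xs i)
  eval (suc k) (compF f gs) xs          = evalVec k gs xs >>= eval k f
  eval (suc k) (recF g h)  (zero ∷ xs)  = eval k g xs
  eval (suc k) (recF g h)  (suc x ∷ xs) =
    eval k (recF g h) (x ∷ xs) >>= λ r → eval k h (x ∷ r ∷ xs)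
  eval (suc k) (minF f)    xs           = search k f xs 0

  evalVec : ℕ → ∀ {n m} → Vec (PR n) m → Vec ℕ n → Maybe (Vec ℕ m)
  evalVec k []       xs = just []
  evalVec k (g ∷ gs) xs =
    eval k g xs >>= λ y → evalVec k gs xs >>= λ ys → just (y ∷ ys)

  search : ℕ → ∀ {n} → PR (suc n) → Vec ℕ n → ℕ → Maybe ℕ
  search zero    f xs i = nothing
  search (suc k) f xs i = eval k f (i ∷ xs) >>= searchStep k f xs i

  searchStep : ℕ → ∀ {n} → PR (suc n) → Vec ℕ n → ℕ → ℕ → Maybe ℕ
  searchStep k f xs i zero    = just i
  searchStep k f xs i (suc _) = search k f xs (suc i)

_⇓_⇒_ : ∀ {n} → PR n → Vec ℕ n → ℕ → Set
f ⇓ xs ⇒ v = ∃ λ k → eval k f xs ≡ just v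

tri : ℕ → ℕ
tri zero    = 0
tri (suc n) = suc n + tri n

pair : ℕ → ℕ → ℕ
pair a b = tri (a + b) + b

-- 3. Countable signatures: symbols are natural numbers; a symbol is
--    present iff its arity is `just n`.

record Signature : Set where
  field
    funAr : ℕ → Maybe ℕ
    relAr : ℕ → Maybe ℕ
open Signature public

module _ (S : Signature) where

  data Term : Set where
    var : ℕ → Term
    app : (f : ℕ) {n : ℕ} → funAr S f ≡ just n → Vec Term n → Term

  data Formula : Set where
    tt ff  : Formula
    _≐_    : Term → Term → Formula
    rel    : (P : ℕ) {n : ℕ} → relAr S P ≡ just n → Vec Term n → Formula
    ~_     : Formula → Formula
    _∧'_   : Formula → Formula → Formula
    _∨'_   : Formula → Formula → Formula
    _⇒'_   : Formula → Formula → Formula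
    all    : ℕ → Formula → Formula
    ex     : ℕ → Formula → Formula

  data QF : Formula → Set where
    qf-tt  : QF tt
    qf-ff  : QF ff
    qf-eq  : ∀ {s t} → QF (s ≐ t)
    qf-rel : ∀ {P n} {p : relAr S P ≡ just n} {ts} → QF (rel P p ts)
    qf-not : ∀ {φ} → QF φ → QF (~ φ)
    qf-and : ∀ {φ ψ} → QF φ → QF ψ → QF (φ ∧' ψ)
    qf-or  : ∀ {φ ψ} → QF φ → QF ψ → QF (φ ∨' ψ)
    qf-imp : ∀ {φ ψ} → QF φ → QF ψ → QF (φ ⇒' ψ)

  mutual
    data OccT (x : ℕ) : Term → Set where
      o-var : OccT x (var x)
      o-app : ∀ {f n} {p : funAr S f ≡ just n} {ts} → OccV x ts → OccT x (app f p ts)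

    data OccV (x : ℕ) : ∀ {n} → Vec Term n → Set where
      o-here  : ∀ {n t} {ts : Vec Term n} → OccT x t → OccV x (t ∷ ts)
      o-there : ∀ {n t} {ts : Vec Term n} → OccV x ts → OccV x (t ∷ ts)

  data Free (x : ℕ) : Formula → Set where
    f-eqˡ : ∀ {s t} → OccT x s → Free x (s ≐ t)
    f-eqʳ : ∀ {s t} → OccT x t → Free x (s ≐ t)
    f-rel : ∀ {P n} {p : relAr S P ≡ just n} {ts} → OccV x ts → Free x (rel P p ts)
    f-not : ∀ {φ} → Free x φ → Free x (~ φ)
    f-andˡ : ∀ {φ ψ} → Free x φ → Free x (φ ∧' ψ)
    f-andʳ : ∀ {φ ψ} → Free x ψ → Free x (φ ∧' ψ)
    f-orˡ  : ∀ {φ ψ} → Free x φ → Free x (φ ∨' ψ)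
    f-orʳ  : ∀ {φ ψ} → Free x ψ → Free x (φ ∨' ψ)
    f-impˡ : ∀ {φ ψ} → Free x φ → Free x (φ ⇒' ψ)
    f-impʳ : ∀ {φ ψ} → Free x ψ → Free x (φ ⇒' ψ)
    f-all  : ∀ {y φ} → x ≢ y → Free x φ → Free x (all y φ)
    f-ex   : ∀ {y φ} → x ≢ y → Free x φ → Free x (ex y φ)

  Sentence : Formula → Set
  Sentence φ = ∀ x → ¬ Free x φ

  record Theory : Set₁ where
    field
      Ax       : Formula → Set
      sentence : ∀ φ → Ax φ → Sentence φ
  open Theory public

  record Structure : Set₁ where
    field
      Dom   : Set
      inhab : Dom
      funI  : (f : ℕ) {n : ℕ} → funAr S f ≡ just n → Vec Dom n → Dom
      relI  : (P : ℕ) {n : ℕ} → relAr S P ≡ just n → Vec Dom n → Set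
  open Structure public

  module _ (M : Structure) where
    update : (ℕ → Dom M) → ℕ → Dom M → ℕ → Dom M
    update σ x d y with Data.Nat._≟_ x y
    ... | Relation.Nullary.yes _ = d
    ... | Relation.Nullary.no  _ = σ y

    mutual
      evalT : (ℕ → Dom M) → Term → Dom M
      evalT σ (var x)      = σ x
      evalT σ (app f p ts) = funI M f p (evalTs σ ts)

      evalTs : (ℕ → Dom M) → ∀ {n} → Vec Term n → Vec (Dom M) n
      evalTs σ []       = []
      evalTs σ (t ∷ ts) = evalT σ t ∷ evalTs σ ts

    Sat : (ℕ → Dom M) → Formula → Set
    Sat σ tt           = ⊤
    Sat σ ff           = ⊥
    Sat σ (s ≐ t)      = evalT σ s ≡ evalT σ t
    Sat σ (rel P p ts) = relI M P p (evalTs σ ts)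
    Sat σ (~ φ)        = ¬ Sat σ φ
    Sat σ (φ ∧' ψ)     = Sat σ φ × Sat σ ψ
    Sat σ (φ ∨' ψ)     = Sat σ φ ⊎ Sat σ ψ
    Sat σ (φ ⇒' ψ)     = Sat σ φ → Sat σ ψ
    Sat σ (all x φ)    = (d : Dom M) → Sat (update σ x d) φ
    Sat σ (ex x φ)     = Σ (Dom M) λ d → Sat (update σ x d) φ

  record Interp (T : Theory) : Set₁ where
    field
      str    : Structure
      assign : ℕ → Dom str
      models : ∀ φ → Ax T φ → Sat str assign φ
  open Interp public

  TSat : Theory → Formula → Set₁
  TSat T φ = Σ (Interp T) λ I → Sat (str I) (assign I) φ

  Finite : Set → Set
  Finite A = Σ ℕ λ n → Fin n ↔ A

  Infinite : Set → Set
  Infinite A = ¬ Finite A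

  StablyInfinite : Theory → Set₁
  StablyInfinite T = ∀ φ → QF φ → TSat T φ →
    Σ (Interp T) λ I → Infinite (Dom (str I)) × Sat (str I) (assign I) φ

  mutual
    codeT : Term → ℕ
    codeT (var x)      = pair 0 x
    codeT (app f p ts) = pair 1 (pair f (codeTs ts))

    codeTs : ∀ {n} → Vec Term n → ℕ
    codeTs []       = 0
    codeTs (t ∷ ts) = suc (pair (codeT t) (codeTs ts))

  code : Formula → ℕ
  code tt           = pair 0 0
  code ff           = pair 1 0
  code (s ≐ t)      = pair 2 (pair (codeT s) (codeT t))
  code (rel P p ts) = pair 3 (pair P (codeTs ts))
  code (~ φ)        = pair 4 (code φ)
  code (φ ∧' ψ)     = pair 5 (pair (code φ) (code ψ))
  code (φ ∨' ψ)     = pair 6 (pair (code φ) (code ψ))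
  code (φ ⇒' ψ)     = pair 7 (pair (code φ) (code ψ))
  code (all x φ)    = pair 8 (pair x (code φ))
  code (ex x φ)     = pair 9 (pair x (code φ))

  DecidableTheory : Theory → Set₁
  DecidableTheory T = Σ (PR 1) λ c → ∀ φ → QF φ →
    (c ⇓ (code φ ∷ []) ⇒ 1 × TSat T φ) ⊎ (c ⇓ (code φ ∷ []) ⇒ 0 × ¬ TSat T φ)

-- 4. Disjoint combination.  Symbols of S₁ are renamed n ↦ 2n, symbols
--    of S₂ are renamed n ↦ 2n+1, so the two signatures share only ≐.

dbl : ℕ → ℕ
dbl zero    = zero
dbl (suc n) = suc (suc (dbl n))

interleave : {A : Set} → (ℕ → A) → (ℕ → A) → ℕ → A
interleave f g zero          = f zero
interleave f g (suc zero)    = g zero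
interleave f g (suc (suc n)) = interleave (λ k → f (suc k)) (λ k → g (suc k)) n

interleave-even : {A : Set} (f g : ℕ → A) (n : ℕ) → interleave f g (dbl n) ≡ f n
interleave-even f g zero    = refl
interleave-even f g (suc n) = interleave-even (λ k → f (suc k)) (λ k → g (suc k)) n

interleave-odd : {A : Set} (f g : ℕ → A) (n : ℕ) → interleave f g (suc (dbl n)) ≡ g n
interleave-odd f g zero    = refl
interleave-odd f g (suc n) = interleave-odd (λ k → f (suc k)) (λ k → g (suc k)) n

_⊕_ : Signature → Signature → Signature
S₁ ⊕ S₂ = record
  { funAr = interleave (funAr S₁) (funAr S₂)
  ; relAr = interleave (relAr S₁) (relAr S₂) }

module Rename (S S' : Signature) (rf rr : ℕ → ℕ)
              (okf : ∀ f → funAr S' (rf f) ≡ funAr S f)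
              (okr : ∀ P → relAr S' (rr P) ≡ relAr S P) where
  mutual
    renT : Term S → Term S'
    renT (var x)      = var x
    renT (app f p ts) = app (rf f) (trans (okf f) p) (renTs ts)

    renTs : ∀ {n} → Vec (Term S) n → Vec (Term S') n
    renTs []       = []
    renTs (t ∷ ts) = renT t ∷ renTs ts

  mutual
    occT : ∀ {x} t → OccT S' x (renT t) → OccT S x t
    occT (var x)      o-var     = o-var
    occT (app f p ts) (o-app o) = o-app (occV ts o)

    occV : ∀ {x n} (ts : Vec (Term S) n) → OccV S' x (renTs ts) → OccV S x ts
    occV (t ∷ ts) (o-here o)  = o-here (occT t o)
    occV (t ∷ ts) (o-there o) = o-there (occV ts o)

  ren : Formula S → Formula S'
  ren tt           = tt
  ren ff           = ff
  ren (s ≐ t)      = renT s ≐ renT t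
  ren (rel P p ts) = rel (rr P) (trans (okr P) p) (renTs ts)
  ren (~ φ)        = ~ ren φ
  ren (φ ∧' ψ)     = ren φ ∧' ren ψ
  ren (φ ∨' ψ)     = ren φ ∨' ren ψ
  ren (φ ⇒' ψ)     = ren φ ⇒' ren ψ
  ren (all x φ)    = all x (ren φ)
  ren (ex x φ)     = ex x (ren φ)

  free : ∀ {x} φ → Free S' x (ren φ) → Free S x φ
  free (s ≐ t)      (f-eqˡ o)   = f-eqˡ (occT s o)
  free (s ≐ t)      (f-eqʳ o)   = f-eqʳ (occT t o)
  free (rel P p ts) (f-rel o)   = f-rel (occV ts o)
  free (~ φ)        (f-not o)   = f-not (free φ o)
  free (φ ∧' ψ)     (f-andˡ o)  = f-andˡ (free φ o)
  free (φ ∧' ψ)     (f-andʳ o)  = f-andʳ (free ψ o)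
  free (φ ∨' ψ)     (f-orˡ o)   = f-orˡ (free φ o)
  free (φ ∨' ψ)     (f-orʳ o)   = f-orʳ (free ψ o)
  free (φ ⇒' ψ)     (f-impˡ o)  = f-impˡ (free φ o)
  free (φ ⇒' ψ)     (f-impʳ o)  = f-impʳ (free ψ o)
  free (all y φ)    (f-all n o) = f-all n (free φ o)
  free (ex y φ)     (f-ex n o)  = f-ex n (free φ o)

  renSentence : ∀ φ → Sentence S φ → Sentence S' (ren φ)
  renSentence φ s x o = s x (free φ o)

module Left (S₁ S₂ : Signature) =
  Rename S₁ (S₁ ⊕ S₂) dbl dbl
         (interleave-even (funAr S₁) (funAr S₂))
         (interleave-even (relAr S₁) (relAr S₂))

module Right (S₁ S₂ : Signature) =
  Rename S₂ (S₁ ⊕ S₂) (λ n → suc (dbl n)) (λ n → suc (dbl n))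
         (interleave-odd (funAr S₁) (funAr S₂))
         (interleave-odd (relAr S₁) (relAr S₂))

_⊔_ : {S₁ S₂ : Signature} → Theory S₁ → Theory S₂ → Theory (S₁ ⊕ S₂)
_⊔_ {S₁} {S₂} T₁ T₂ = record
  { Ax = λ ψ → (Σ (Formula S₁) λ φ → Ax T₁ φ × ψ ≡ Left.ren S₁ S₂ φ)
             ⊎ (Σ (Formula S₂) λ φ → Ax T₂ φ × ψ ≡ Right.ren S₁ S₂ φ)
  ; sentence = sent }
  where
  sent : ∀ ψ → _ → Sentence (S₁ ⊕ S₂) ψ
  sent ψ (inj₁ (φ , a , refl)) = Left.renSentence S₁ S₂ φ (sentence T₁ φ a)
  sent ψ (inj₂ (φ , a , refl)) = Right.renSentence S₁ S₂ φ (sentence T₂ φ a)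

{-# OPTIONS --safe #-}
-- Suppose φ is T-satisfiable but has no infinite T-model.  For A ⊆ ℕ let T[ A ] be the theory
-- over nullary predicates Q₀, Q₁, … saying that Qₘ forces at least k elements, for all m ∈ A
-- and all k.  Every T[ A ] is stably infinite, and all of them are decided by one program: a
-- quantifier-free formula is T[ A ]-satisfiable iff it holds in ℕ under one of boundedly many
-- assignments (send each variable to the least variable with the same value).
--
-- Let A be the set of codes m of programs accepting φ ∧ Qₘ, and let c decide T ⊔ T[ A ], with
-- code m.  If c accepts φ ∧ Qₘ then m ∈ A, so a model of φ ∧ Qₘ is an infinite model of φ.  If c
-- rejects it then m ∉ A, so a model of φ in which Qⱼ means j = m is a model of T ⊔ T[ A ] and of
-- φ ∧ Qₘ.
module Submission where

open import Defs
open import Level using (0ℓ; lift; lower) renaming (suc to lsuc)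
open import Axiom.ExcludedMiddle using (ExcludedMiddle)
open import Data.Bool using (Bool; true; false; _∧_; T)
open import Data.Bool.Properties using (T-∧)
open import Data.Nat using (ℕ; zero; suc; pred; _+_; _∸_; _≤_; _<_; _≤′_; ≤′-refl; ≤′-step; _≤?_; _≟_; z≤n; s≤s; _⊓_)
  renaming (_⊔_ to _⊔ℕ_)
open import Data.Nat.Properties
open import Data.Fin using (toℕ; #_)
open import Data.Fin.Properties using (pigeonhole; toℕ-injective; toℕ<n)
open import Data.Vec using (Vec; []; _∷_; lookup)
open import Data.Maybe using (Maybe; nothing; just; _>>=_)
open import Data.Maybe.Properties using (just-injective)
open import Data.Product using (Σ; ∃; _×_; _,_; proj₁; proj₂)
open import Data.Product.Function.NonDependent.Propositional using (_×-⇔_)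
open import Data.Sum using (_⊎_; inj₁; inj₂)
open import Data.Sum.Function.Propositional using (_⊎-⇔_)
open import Data.Unit using (tt)
open import Function using (_∘_)
open import Function.Bundles using (_⇔_; mk⇔; Equivalence; Inverse)
open import Function.Properties.Equivalence using () renaming (sym to ⇔-sym)
open import Function.Related.TypeIsomorphisms using (→-cong-⇔; ¬-cong-⇔)
open import Relation.Nullary using (¬_; Dec; yes; no; contradiction)
open import Relation.Nullary.Decidable using (map′)
open import Relation.Unary using (Decidable)
open import Relation.Binary using (tri<; tri≈; tri>)
open import Relation.Binary.PropositionalEquality

-- Minimisation-free programs

mutual
  ⟦_⟧ : ∀ {n} → PR n → Vec ℕ n → ℕ
  ⟦ zeroF ⟧      _        = 0
  ⟦ succF ⟧      (x ∷ []) = suc x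
  ⟦ projF i ⟧    xs       = lookup xs i
  ⟦ compF f gs ⟧ xs       = ⟦ f ⟧ (⟦ gs ⟧* xs)
  ⟦ recF g h ⟧   (x ∷ xs) = ⟦rec⟧ g h x xs
  ⟦ minF _ ⟧     _        = 0   -- junk: ⟦_⟧ is only used on minimisation-free programs

  ⟦_⟧* : ∀ {n m} → Vec (PR n) m → Vec ℕ n → Vec ℕ m
  ⟦ [] ⟧*     _  = []
  ⟦ g ∷ gs ⟧* xs = ⟦ g ⟧ xs ∷ ⟦ gs ⟧* xs

  ⟦rec⟧ : ∀ {n} → PR n → PR (suc (suc n)) → ℕ → Vec ℕ n → ℕ
  ⟦rec⟧ g h zero    xs = ⟦ g ⟧ xs
  ⟦rec⟧ g h (suc x) xs = ⟦ h ⟧ (x ∷ ⟦rec⟧ g h x xs ∷ xs)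

mutual
  isMinFree : ∀ {n} → PR n → Bool
  isMinFree (compF f gs) = isMinFree f ∧ isMinFree* gs
  isMinFree (recF g h)   = isMinFree g ∧ isMinFree h
  isMinFree (minF _)     = false
  isMinFree _            = true

  isMinFree* : ∀ {n m} → Vec (PR n) m → Bool
  isMinFree* []       = true
  isMinFree* (g ∷ gs) = isMinFree g ∧ isMinFree* gs

⟦_⟧₁ : PR 1 → ℕ → ℕ
⟦ f ⟧₁ x = ⟦ f ⟧ (x ∷ [])

⟦_⟧₂ : PR 2 → ℕ → ℕ → ℕ
⟦ f ⟧₂ x y = ⟦ f ⟧ (x ∷ y ∷ [])

fuel-mono : ∀ {A : Set} (F : ℕ → Maybe A) → (∀ {k v} → F k ≡ just v → F (suc k) ≡ just v) →
            ∀ {k j v} → k ≤ j → F k ≡ just v → F j ≡ just v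
fuel-mono F step k≤j = go (≤⇒≤′ k≤j)
  where
  go : ∀ {k j v} → k ≤′ j → F k ≡ just v → F j ≡ just v
  go ≤′-refl       e = e
  go (≤′-step k≤j) e = step (go k≤j e)

mutual
  eval-suc : ∀ k {n} (f : PR n) xs {v} → eval k f xs ≡ just v → eval (suc k) f xs ≡ just v
  eval-suc (suc k) zeroF        xs           e = e
  eval-suc (suc k) succF        (x ∷ [])     e = e
  eval-suc (suc k) (projF i)    xs           e = e
  eval-suc (suc k) (compF f gs) xs           e with evalVec k gs xs in eq
  ... | just ys rewrite evalVec-suc k gs xs eq = eval-suc k f ys e
  eval-suc (suc k) (recF g h)   (zero ∷ xs)  e = eval-suc k g xs e
  eval-suc (suc k) (recF g h)   (suc x ∷ xs) e with eval k (recF g h) (x ∷ xs) in eq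
  ... | just r rewrite eval-suc k (recF g h) (x ∷ xs) eq = eval-suc k h (x ∷ r ∷ xs) e
  eval-suc (suc k) (minF f)     xs           e = search-suc k f xs 0 e

  evalVec-suc : ∀ k {n m} (gs : Vec (PR n) m) xs {vs} → evalVec k gs xs ≡ just vs → evalVec (suc k) gs xs ≡ just vs
  evalVec-suc k []       xs e = e
  evalVec-suc k (g ∷ gs) xs e with eval k g xs in eq₁
  ... | just y with evalVec k gs xs in eq₂
  ... | just ys rewrite eval-suc k g xs eq₁ | evalVec-suc k gs xs eq₂ = e

  search-suc : ∀ k {n} (f : PR (suc n)) xs i {v} → search k f xs i ≡ just v → search (suc k) f xs i ≡ just v
  search-suc (suc k) f xs i e with eval k f (i ∷ xs) in eq
  ... | just r rewrite eval-suc k f (i ∷ xs) eq = searchStep-suc k f xs i r e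

  searchStep-suc : ∀ k {n} (f : PR (suc n)) xs i r {v} → searchStep k f xs i r ≡ just v → searchStep (suc k) f xs i r ≡ just v
  searchStep-suc k f xs i zero    e = e
  searchStep-suc k f xs i (suc r) e = search-suc k f xs (suc i) e

eval-mono : ∀ {n} {f : PR n} {xs k j v} → k ≤ j → eval k f xs ≡ just v → eval j f xs ≡ just v
eval-mono {f = f} {xs} = fuel-mono (λ k → eval k f xs) (eval-suc _ f xs)

evalVec-mono : ∀ {n m} {gs : Vec (PR n) m} {xs k j vs} → k ≤ j → evalVec k gs xs ≡ just vs → evalVec j gs xs ≡ just vs
evalVec-mono {gs = gs} {xs} = fuel-mono (λ k → evalVec k gs xs) (evalVec-suc _ gs xs)

⇓-deterministic : ∀ {n} {f : PR n} {xs v w} → f ⇓ xs ⇒ v → f ⇓ xs ⇒ w → v ≡ w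
⇓-deterministic (k , e) (j , e') =
  just-injective (trans (sym (eval-mono (m≤m⊔n k j) e)) (eval-mono (m≤n⊔m k j) e'))

>>=-just : ∀ {A B : Set} {m : Maybe A} {a} (g : A → Maybe B) → m ≡ just a → (m >>= g) ≡ g a
>>=-just g refl = refl

mutual
  minFree-halts : ∀ {n} (f : PR n) → T (isMinFree f) → ∀ xs → f ⇓ xs ⇒ ⟦ f ⟧ xs
  minFree-halts zeroF        _ xs       = 1 , refl
  minFree-halts succF        _ (x ∷ []) = 1 , refl
  minFree-halts (projF i)    _ xs       = 1 , refl
  minFree-halts (compF f gs) m xs       =
    let mf , mgs = Equivalence.to T-∧ m
        k₁ , e₁ = minFree-halts* gs mgs xs
        k₂ , e₂ = minFree-halts f mf (⟦ gs ⟧* xs)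
    in suc (k₁ ⊔ℕ k₂) , trans (>>=-just (eval (k₁ ⊔ℕ k₂) f) (evalVec-mono {gs = gs} (m≤m⊔n k₁ k₂) e₁))
                             (eval-mono (m≤n⊔m k₁ k₂) e₂)
  minFree-halts (recF g h)   m (x ∷ xs) = let mg , mh = Equivalence.to T-∧ m in recF-halts mg mh x xs

  recF-halts : ∀ {n} {g : PR n} {h} → T (isMinFree g) → T (isMinFree h) → ∀ x xs → recF g h ⇓ x ∷ xs ⇒ ⟦rec⟧ g h x xs
  recF-halts {g = g} mg mh zero    xs = let k , e = minFree-halts g mg xs in suc k , e
  recF-halts {g = g} {h} mg mh (suc x) xs =
    let k₁ , e₁ = recF-halts mg mh x xs
        k₂ , e₂ = minFree-halts h mh (x ∷ ⟦rec⟧ g h x xs ∷ xs)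
    in suc (k₁ ⊔ℕ k₂) , trans (>>=-just (λ r → eval (k₁ ⊔ℕ k₂) h (x ∷ r ∷ xs)) (eval-mono (m≤m⊔n k₁ k₂) e₁))
                             (eval-mono (m≤n⊔m k₁ k₂) e₂)

  minFree-halts* : ∀ {n m} (gs : Vec (PR n) m) → T (isMinFree* gs) → ∀ xs → ∃ λ k → evalVec k gs xs ≡ just (⟦ gs ⟧* xs)
  minFree-halts* []       _ xs = 0 , refl
  minFree-halts* (g ∷ gs) m xs =
    let mg , mgs = Equivalence.to T-∧ m
        k₁ , e₁ = minFree-halts g mg xs
        k₂ , e₂ = minFree-halts* gs mgs xs
    in k₁ ⊔ℕ k₂ , trans (>>=-just _ (eval-mono (m≤m⊔n k₁ k₂) e₁))
                       (>>=-just _ (evalVec-mono {gs = gs} (m≤n⊔m k₁ k₂) e₂))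

-- Arithmetic and Cantor pairing

comp₁ : ∀ {n} → PR 1 → PR n → PR n
comp₁ f g = compF f (g ∷ [])

comp₂ : ∀ {n} → PR 2 → PR n → PR n → PR n
comp₂ f g h = compF f (g ∷ h ∷ [])

comp₃ : ∀ {n} → PR 3 → PR n → PR n → PR n → PR n
comp₃ f g h k = compF f (g ∷ h ∷ k ∷ [])

constP : ∀ {n} → ℕ → PR n
constP zero    = zeroF
constP (suc c) = comp₁ succF (constP c)

addP : PR 2
addP = recF (projF (# 0)) (comp₁ succF (projF (# 1)))

addP-correct : ∀ x y → ⟦ addP ⟧₂ x y ≡ x + y
addP-correct zero    y = refl
addP-correct (suc x) y = cong suc (addP-correct x y)

predP : PR 1
predP = recF zeroF (projF (# 0))

predP-correct : ∀ x → ⟦ predP ⟧₁ x ≡ pred x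
predP-correct zero    = refl
predP-correct (suc x) = refl

-- recursion runs on the first argument, so this computes the flipped difference
flippedMonusP : PR 2
flippedMonusP = recF (projF (# 0)) (comp₁ predP (projF (# 1)))

flippedMonusP-correct : ∀ y x → ⟦ flippedMonusP ⟧₂ y x ≡ x ∸ y
flippedMonusP-correct zero    x = refl
flippedMonusP-correct (suc y) x = begin
  ⟦ predP ⟧₁ (⟦ flippedMonusP ⟧₂ y x) ≡⟨ predP-correct (⟦ flippedMonusP ⟧₂ y x) ⟩
  pred (⟦ flippedMonusP ⟧₂ y x)       ≡⟨ cong pred (flippedMonusP-correct y x) ⟩
  pred (x ∸ y)                        ≡⟨ pred[m∸n]≡m∸[1+n] x y ⟩
  x ∸ suc y                           ∎
  where open ≡-Reasoning

monusP : PR 2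
monusP = comp₂ flippedMonusP (projF (# 1)) (projF (# 0))

monusP-correct : ∀ x y → ⟦ monusP ⟧₂ x y ≡ x ∸ y
monusP-correct x y = flippedMonusP-correct y x

isZero : ℕ → ℕ
isZero zero    = 1
isZero (suc _) = 0

isZeroP : PR 1
isZeroP = recF (constP 1) zeroF

isZeroP-correct : ∀ x → ⟦ isZeroP ⟧₁ x ≡ isZero x
isZeroP-correct zero    = refl
isZeroP-correct (suc x) = refl

mulP : PR 2
mulP = recF zeroF (comp₂ addP (projF (# 1)) (projF (# 2)))

triP : PR 1
triP = recF zeroF (comp₂ addP (comp₁ succF (projF (# 0))) (projF (# 1)))

triP-correct : ∀ x → ⟦ triP ⟧₁ x ≡ tri x
triP-correct zero    = refl
triP-correct (suc x) = trans (addP-correct (suc x) _) (cong (suc x +_) (triP-correct x))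

pairP : PR 2
pairP = comp₂ addP (comp₁ triP (comp₂ addP (projF (# 0)) (projF (# 1)))) (projF (# 1))

pairP-correct : ∀ a b → ⟦ pairP ⟧₂ a b ≡ pair a b
pairP-correct a b rewrite addP-correct a b | triP-correct (a + b) = addP-correct (tri (a + b)) b

tri-mono : ∀ {m n} → m ≤ n → tri m ≤ tri n
tri-mono {zero}  {n}     _         = z≤n
tri-mono {suc m} {suc n} (s≤s m≤n) = +-mono-≤ (s≤s m≤n) (tri-mono m≤n)

n≤tri : ∀ n → n ≤ tri n
n≤tri zero    = z≤n
n≤tri (suc n) = m≤m+n (suc n) (tri n)

leP : PR 2
leP = comp₁ isZeroP monusP

leP-correct : ∀ x y → ⟦ leP ⟧₂ x y ≡ isZero (x ∸ y)
leP-correct x y = trans (isZeroP-correct _) (cong isZero (monusP-correct x y))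

isZero-∸-≤ : ∀ {x y} → x ≤ y → isZero (x ∸ y) ≡ 1
isZero-∸-≤ x≤y rewrite m≤n⇒m∸n≡0 x≤y = refl

isZero-∸-> : ∀ {x y} → y < x → isZero (x ∸ y) ≡ 0
isZero-∸-> {suc x} {zero}  _         = refl
isZero-∸-> {suc x} {suc y} (s≤s y<x) = isZero-∸-> y<x

-- ⟦ countTriBelowP ⟧₂ t c counts the s ∈ [1, t] with tri s ≤ c
countTriBelowP : PR 2
countTriBelowP = recF zeroF (comp₂ addP (projF (# 1)) (comp₂ leP (comp₁ triP (comp₁ succF (projF (# 0)))) (projF (# 2))))

countTriBelowP-correct : ∀ c s → tri s ≤ c → c < tri (suc s) → ∀ t → ⟦ countTriBelowP ⟧₂ t c ≡ t ⊓ s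
countTriBelowP-correct c s lo hi zero    = refl
countTriBelowP-correct c s lo hi (suc t)
  rewrite addP-correct (⟦ countTriBelowP ⟧₂ t c) (⟦ leP ⟧₂ (⟦ triP ⟧₁ (suc t)) c)
        | leP-correct (⟦ triP ⟧₁ (suc t)) c
        | triP-correct (suc t)
        | countTriBelowP-correct c s lo hi t = step (suc t ≤? s)
  where
  step : Dec (suc t ≤ s) → t ⊓ s + isZero (tri (suc t) ∸ c) ≡ suc t ⊓ s
  step (yes t<s) rewrite isZero-∸-≤ (≤-trans (tri-mono t<s) lo) | m≤n⇒m⊓n≡m t<s
                       | m≤n⇒m⊓n≡m (≤-trans (n≤1+n t) t<s) = +-comm t 1
  step (no t≮s) rewrite isZero-∸-> {tri (suc t)} {c} (<-≤-trans hi (tri-mono (≰⇒> t≮s)))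
                      | m≥n⇒m⊓n≡n (≤-pred (≰⇒> t≮s)) | m≥n⇒m⊓n≡n (≤-trans (n≤1+n s) (≰⇒> t≮s)) = +-identityʳ s

diagonalP : PR 1
diagonalP = comp₂ countTriBelowP (projF (# 0)) (projF (# 0))

diagonalP-pair : ∀ a b → ⟦ diagonalP ⟧₁ (pair a b) ≡ a + b
diagonalP-pair a b = trans (countTriBelowP-correct (pair a b) (a + b) lo hi (pair a b))
                           (m≥n⇒m⊓n≡n (≤-trans (n≤tri (a + b)) lo))
  where
  lo : tri (a + b) ≤ pair a b
  lo = m≤m+n (tri (a + b)) b
  hi : pair a b < tri (suc (a + b))
  hi = subst (_≤ tri (suc (a + b))) (+-suc (tri (a + b)) b)
         (subst (tri (a + b) + suc b ≤_) (+-comm (tri (a + b)) (suc (a + b)))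
           (+-monoʳ-≤ (tri (a + b)) (s≤s (m≤n+m b a))))

unpair₂P : PR 1
unpair₂P = comp₂ monusP (projF (# 0)) (comp₁ triP diagonalP)

unpair₁P : PR 1
unpair₁P = comp₂ monusP diagonalP unpair₂P

opaque
  unpair₁ unpair₂ : ℕ → ℕ
  unpair₁ = ⟦ unpair₁P ⟧₁
  unpair₂ = ⟦ unpair₂P ⟧₁

  unpair₂-pair : ∀ a b → unpair₂ (pair a b) ≡ b
  unpair₂-pair a b rewrite monusP-correct (pair a b) (⟦ triP ⟧₁ (⟦ diagonalP ⟧₁ (pair a b)))
                         | triP-correct (⟦ diagonalP ⟧₁ (pair a b)) | diagonalP-pair a b =
    m+n∸m≡n (tri (a + b)) b

  unpair₁-pair : ∀ a b → unpair₁ (pair a b) ≡ a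
  unpair₁-pair a b = begin
    ⟦ monusP ⟧₂ d (unpair₂ (pair a b)) ≡⟨ monusP-correct d (unpair₂ (pair a b)) ⟩
    d ∸ unpair₂ (pair a b)             ≡⟨ cong₂ _∸_ (diagonalP-pair a b) (unpair₂-pair a b) ⟩
    a + b ∸ b                          ≡⟨ m+n∸n≡m a b ⟩
    a                                  ∎
    where
    open ≡-Reasoning
    d : ℕ
    d = ⟦ diagonalP ⟧₁ (pair a b)

pair-injective : ∀ {a b a′ b′} → pair a b ≡ pair a′ b′ → a ≡ a′ × b ≡ b′
pair-injective {a} {b} {a′} {b′} e =
  trans (sym (unpair₁-pair a b)) (trans (cong unpair₁ e) (unpair₁-pair a′ b′)) ,
  trans (sym (unpair₂-pair a b)) (trans (cong unpair₂ e) (unpair₂-pair a′ b′))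

pair-mono : ∀ {a b a′ b′} → a ≤ a′ → b ≤ b′ → pair a b ≤ pair a′ b′
pair-mono a≤a′ b≤b′ = +-mono-≤ (tri-mono (+-mono-≤ a≤a′ b≤b′)) b≤b′

≤-pairˡ : ∀ a b → a ≤ pair a b
≤-pairˡ a b = ≤-trans (≤-trans (m≤m+n a b) (n≤tri (a + b))) (m≤m+n (tri (a + b)) b)

≤-pairʳ : ∀ a b → b ≤ pair a b
≤-pairʳ a b = m≤n+m b (tri (a + b))

<-pair-suc : ∀ k b → b < pair (suc k) b
<-pair-suc k b = ≤-trans (s≤s (m≤n+m b k)) (≤-trans (n≤tri (suc k + b)) (m≤m+n (tri (suc k + b)) b))

-- Propositions reflected by 0 and 1

data Reflects {ℓ} (A : Set ℓ) : ℕ → Set ℓ where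
  ofʸ : A → Reflects A 1
  ofⁿ : ¬ A → Reflects A 0

_reflects_ : ∀ {ℓ} → ℕ → Set ℓ → Set ℓ
v reflects A = Reflects A v

reflects-subst : ∀ {ℓ} {A : Set ℓ} {v w} → v ≡ w → w reflects A → v reflects A
reflects-subst refl r = r

reflects-⇔ : ∀ {a b} {A : Set a} {B : Set b} {v} → A ⇔ B → v reflects A → v reflects B
reflects-⇔ A⇔B (ofʸ a)  = ofʸ (Equivalence.to A⇔B a)
reflects-⇔ A⇔B (ofⁿ ¬a) = ofⁿ (λ b → ¬a (Equivalence.from A⇔B b))

reflects⇒≢0⇔ : ∀ {ℓ} {A : Set ℓ} {v} → v reflects A → (v ≢ 0) ⇔ A
reflects⇒≢0⇔ (ofʸ a)  = mk⇔ (λ _ → a) (λ _ ())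
reflects⇒≢0⇔ (ofⁿ ¬a) = mk⇔ (λ v≢0 → contradiction refl v≢0) (λ a → contradiction a ¬a)

reflects-¬ : ∀ {A : Set} {v} → v reflects A → ⟦ monusP ⟧₂ 1 v reflects (¬ A)
reflects-¬ (ofʸ a)  = ofⁿ (λ ¬a → ¬a a)
reflects-¬ (ofⁿ ¬a) = ofʸ ¬a

reflects-× : ∀ {A B : Set} {u v} → u reflects A → v reflects B → ⟦ mulP ⟧₂ u v reflects (A × B)
reflects-× (ofʸ a)  (ofʸ b)  = ofʸ (a , b)
reflects-× (ofʸ _)  (ofⁿ ¬b) = ofⁿ (λ (_ , b) → ¬b b)
reflects-× (ofⁿ ¬a) _        = ofⁿ (λ (a , _) → ¬a a)

reflects-→ : ∀ {A B : Set} {u v} → u reflects A → v reflects B → ⟦ isZeroP ⟧₁ (⟦ mulP ⟧₂ u (⟦ monusP ⟧₂ 1 v)) reflects (A → B)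
reflects-→ (ofʸ a)  (ofʸ b)  = ofʸ (λ _ → b)
reflects-→ (ofʸ a)  (ofⁿ ¬b) = ofⁿ (λ f → ¬b (f a))
reflects-→ (ofⁿ ¬a) (ofʸ b)  = ofʸ (λ _ → b)
reflects-→ (ofⁿ ¬a) (ofⁿ _)  = ofʸ (λ a → contradiction a ¬a)

nonZeroP : PR 1
nonZeroP = comp₁ isZeroP isZeroP

nonZeroP-reflects : ∀ x → ⟦ nonZeroP ⟧₁ x reflects (x ≢ 0)
nonZeroP-reflects zero    = ofⁿ (λ 0≢0 → 0≢0 refl)
nonZeroP-reflects (suc x) = ofʸ (λ ())

nonZeroP-+-reflects : ∀ u v → ⟦ nonZeroP ⟧₁ (⟦ addP ⟧₂ u v) reflects (u ≢ 0 ⊎ v ≢ 0)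
nonZeroP-+-reflects (suc u) v       = ofʸ (inj₁ (λ ()))
nonZeroP-+-reflects zero    (suc v) = ofʸ (inj₂ (λ ()))
nonZeroP-+-reflects zero    zero    = ofⁿ λ { (inj₁ 0≢0) → 0≢0 refl ; (inj₂ 0≢0) → 0≢0 refl }

leP-reflects : ∀ x y → ⟦ leP ⟧₂ x y reflects (x ≤ y)
leP-reflects x y with x ≤? y
... | yes x≤y = reflects-subst (trans (leP-correct x y) (isZero-∸-≤ x≤y)) (ofʸ x≤y)
... | no  x≰y = reflects-subst (trans (leP-correct x y) (isZero-∸-> (≰⇒> x≰y))) (ofⁿ x≰y)

eqP : PR 2
eqP = comp₂ mulP leP (comp₂ leP (projF (# 1)) (projF (# 0)))

eqP-reflects : ∀ x y → ⟦ eqP ⟧₂ x y reflects (x ≡ y)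
eqP-reflects x y = reflects-⇔ (mk⇔ (λ (x≤y , y≤x) → ≤-antisym x≤y y≤x) (λ { refl → ≤-refl , ≤-refl }))
                              (reflects-× (leP-reflects x y) (leP-reflects y x))

anyBelowP : PR 2 → PR 2
anyBelowP f = recF (comp₁ nonZeroP (comp₂ f (projF (# 0)) (constP 0)))
                   (comp₁ nonZeroP (comp₂ addP (projF (# 1)) (comp₂ f (projF (# 2)) (comp₁ succF (projF (# 0))))))

anyBelowP-reflects : ∀ f t n → ⟦ anyBelowP f ⟧₂ t n reflects (Σ ℕ λ a → a ≤ t × ⟦ f ⟧₂ n a ≢ 0)
anyBelowP-reflects f zero    n = reflects-⇔ (mk⇔ (λ v≢0 → 0 , z≤n , v≢0) λ { (0 , _ , v≢0) → v≢0 })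
                                            (nonZeroP-reflects (⟦ f ⟧₂ n 0))
anyBelowP-reflects f (suc t) n =
  reflects-⇔ (mk⇔ to from) (nonZeroP-+-reflects (⟦ anyBelowP f ⟧₂ t n) (⟦ f ⟧₂ n (suc t)))
  where
  below-t = reflects⇒≢0⇔ (anyBelowP-reflects f t n)
  to : ⟦ anyBelowP f ⟧₂ t n ≢ 0 ⊎ ⟦ f ⟧₂ n (suc t) ≢ 0 → Σ ℕ λ a → a ≤ suc t × ⟦ f ⟧₂ n a ≢ 0
  to (inj₁ w≢0) = let a , a≤t , v≢0 = Equivalence.to below-t w≢0 in a , m≤n⇒m≤1+n a≤t , v≢0
  to (inj₂ v≢0) = suc t , ≤-refl , v≢0
  from : (Σ ℕ λ a → a ≤ suc t × ⟦ f ⟧₂ n a ≢ 0) → ⟦ anyBelowP f ⟧₂ t n ≢ 0 ⊎ ⟦ f ⟧₂ n (suc t) ≢ 0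
  from (a , a≤1+t , v≢0) with m≤n⇒m<n∨m≡n a≤1+t
  ... | inj₁ (s≤s a≤t) = inj₁ (Equivalence.from below-t (a , a≤t , v≢0))
  ... | inj₂ refl      = inj₂ v≢0

reflects-halting : ∀ {ℓ} {A : Set ℓ} {n} {f : PR n} {xs v} → f ⇓ xs ⇒ v → v reflects A →
                   (f ⇓ xs ⇒ 1 × A) ⊎ (f ⇓ xs ⇒ 0 × ¬ A)
reflects-halting f⇓ (ofʸ a)  = inj₁ (f⇓ , a)
reflects-halting f⇓ (ofⁿ ¬a) = inj₂ (f⇓ , ¬a)

-- Evaluating quantifier-free formulas over nullary predicates

-- Lists are encoded with pair as cons and 0 as nil.
dropP : PR 2
dropP = recF (projF (# 0)) (comp₁ unpair₂P (projF (# 1)))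

lookupP : PR 2
lookupP = comp₁ unpair₁P (comp₂ dropP (projF (# 1)) (projF (# 0)))

opaque
  unfolding unpair₁ unpair₂

  lookupᴺ : ℕ → ℕ → ℕ
  lookupᴺ = ⟦ lookupP ⟧₂

  drop-suc : ∀ k ℓ → ⟦ dropP ⟧₂ (suc k) ℓ ≡ ⟦ dropP ⟧₂ k (unpair₂ ℓ)
  drop-suc zero    ℓ = refl
  drop-suc (suc k) ℓ = cong unpair₂ (drop-suc k ℓ)

  lookupᴺ-zero : ∀ a ℓ → lookupᴺ (pair a ℓ) 0 ≡ a
  lookupᴺ-zero = unpair₁-pair

  lookupᴺ-suc : ∀ a ℓ i → lookupᴺ (pair a ℓ) (suc i) ≡ lookupᴺ ℓ i
  lookupᴺ-suc a ℓ i = cong unpair₁ (trans (drop-suc i (pair a ℓ)) (cong (⟦ dropP ⟧₂ i) (unpair₂-pair a ℓ)))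

encodeList : (ℕ → ℕ) → ℕ → ℕ
encodeList e zero    = 0
encodeList e (suc k) = pair (e 0) (encodeList (e ∘ suc) k)

lookup-encodeList : ∀ k e i → i < k → lookupᴺ (encodeList e k) i ≡ e i
lookup-encodeList (suc k) e zero    _         = lookupᴺ-zero (e 0) (encodeList (e ∘ suc) k)
lookup-encodeList (suc k) e (suc i) (s≤s i<k) =
  trans (lookupᴺ-suc (e 0) (encodeList (e ∘ suc) k) i) (lookup-encodeList k (e ∘ suc) i i<k)

encodeList-mono : ∀ k {e e′} → (∀ i → i < k → e i ≤ e′ i) → encodeList e k ≤ encodeList e′ k
encodeList-mono zero    _  = z≤n
encodeList-mono (suc k) e≤ = pair-mono (e≤ 0 (s≤s z≤n)) (encodeList-mono k (λ i i<k → e≤ (suc i) (s≤s i<k)))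

replicateP : PR 2
replicateP = recF zeroF (comp₂ pairP (projF (# 2)) (projF (# 1)))

replicateP-correct : ∀ k m → ⟦ replicateP ⟧₂ k m ≡ encodeList (λ _ → m) k
replicateP-correct zero    m = refl
replicateP-correct (suc k) m = trans (pairP-correct m _) (cong (pair m) (replicateP-correct k m))

-- An assignment is a number a = pair xs qs: variable x denotes entry x of xs, and the
-- nullary predicate j holds iff entry j of qs is nonzero.
valuation : ℕ → ℕ → ℕ
valuation a = lookupᴺ (unpair₁ a)

atom : ℕ → ℕ → ℕ
atom a = lookupᴺ (unpair₂ a)

-- history lists the values at the codes c ∸ 1, …, 0, so code i sits at position c ∸ suc i
recall : ℕ → ℕ → ℕ → ℕ
recall ℓ c i = lookupᴺ ℓ (⟦ monusP ⟧₂ c (suc i))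

-- Tags and layouts of bodies are those of `code`.
truthStep : (tag body a history c : ℕ) → ℕ
truthStep 0 b a ℓ c = 1
truthStep 1 b a ℓ c = 0
truthStep 2 b a ℓ c = ⟦ eqP ⟧₂ (valuation a (unpair₂ (unpair₁ b))) (valuation a (unpair₂ (unpair₂ b)))
truthStep 3 b a ℓ c = ⟦ nonZeroP ⟧₁ (atom a (unpair₁ b))
truthStep 4 b a ℓ c = ⟦ monusP ⟧₂ 1 (recall ℓ c b)
truthStep 5 b a ℓ c = ⟦ mulP ⟧₂ (recall ℓ c (unpair₁ b)) (recall ℓ c (unpair₂ b))
truthStep 6 b a ℓ c = ⟦ nonZeroP ⟧₁ (⟦ addP ⟧₂ (recall ℓ c (unpair₁ b)) (recall ℓ c (unpair₂ b)))
truthStep 7 b a ℓ c = ⟦ isZeroP ⟧₁ (⟦ mulP ⟧₂ (recall ℓ c (unpair₁ b)) (⟦ monusP ⟧₂ 1 (recall ℓ c (unpair₂ b))))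
truthStep (suc (suc (suc (suc (suc (suc (suc (suc _)))))))) b a ℓ c = 0

opaque
  truthStepP : PR 5
  truthStepP =
    case 0 (constP 1) (
    case 1 (constP 0) (
    case 2 (comp₂ eqP (valuationP (snd (fst body))) (valuationP (snd (snd body)))) (
    case 3 (comp₁ nonZeroP (atomP (fst body))) (
    case 4 (comp₂ monusP (constP 1) (recallP body)) (
    case 5 (comp₂ mulP (recallP (fst body)) (recallP (snd body))) (
    case 6 (comp₁ nonZeroP (comp₂ addP (recallP (fst body)) (recallP (snd body)))) (
    case 7 (comp₁ isZeroP (comp₂ mulP (recallP (fst body)) (comp₂ monusP (constP 1) (recallP (snd body))))) (
    constP 0))))))))
    where
    tag body a ℓ c : PR 5
    tag  = projF (# 0)
    body = projF (# 1)
    a    = projF (# 2)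
    ℓ    = projF (# 3)
    c    = projF (# 4)
    fst snd valuationP atomP recallP : PR 5 → PR 5
    fst = comp₁ unpair₁P
    snd = comp₁ unpair₂P
    valuationP = comp₂ lookupP (fst a)
    atomP      = comp₂ lookupP (snd a)
    recallP i  = comp₂ lookupP ℓ (comp₂ monusP c (comp₁ succF i))
    -- ⟦ ifP ⟧ (x ∷ y ∷ z ∷ []) is y if x ≢ 0 and z otherwise
    ifP : PR 3
    ifP = recF (projF (# 1)) (projF (# 2))
    case : ℕ → PR 5 → PR 5 → PR 5
    case k v otherwise = comp₃ ifP (comp₂ eqP tag (constP k)) v otherwise

stepP : PR 3
stepP = compF truthStepP
  (comp₁ unpair₁P (projF (# 0)) ∷ comp₁ unpair₂P (projF (# 0)) ∷ projF (# 1) ∷ projF (# 2) ∷ projF (# 0) ∷ [])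

historyP : PR 2
historyP = recF zeroF (comp₂ pairP (comp₃ stepP (projF (# 0)) (projF (# 2)) (projF (# 1))) (projF (# 1)))

truthP : PR 2
truthP = comp₃ stepP (projF (# 0)) (projF (# 1)) historyP

opaque
  unfolding truthStepP lookupᴺ

  stepP-correct : ∀ c a ℓ → ⟦ stepP ⟧ (c ∷ a ∷ ℓ ∷ []) ≡ truthStep (unpair₁ c) (unpair₂ c) a ℓ c
  stepP-correct c a ℓ = cases (unpair₁ c)
    where
    cases : ∀ t → ⟦ truthStepP ⟧ (t ∷ unpair₂ c ∷ a ∷ ℓ ∷ c ∷ []) ≡ truthStep t (unpair₂ c) a ℓ c
    cases 0 = refl
    cases 1 = refl
    cases 2 = refl
    cases 3 = refl
    cases 4 = refl
    cases 5 = refl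
    cases 6 = refl
    cases 7 = refl
    cases (suc (suc (suc (suc (suc (suc (suc (suc _)))))))) = refl

opaque
  history truth : ℕ → ℕ → ℕ
  history = ⟦ historyP ⟧₂
  truth   = ⟦ truthP ⟧₂

  truthP-correct : ∀ c a → ⟦ truthP ⟧₂ c a ≡ truth c a
  truthP-correct c a = refl

  history-suc : ∀ c a → history (suc c) a ≡ pair (truth c a) (history c a)
  history-suc c a = pairP-correct (truth c a) (history c a)

  truth-unfold : ∀ c a → truth c a ≡ truthStep (unpair₁ c) (unpair₂ c) a (history c a) c
  truth-unfold c a = stepP-correct c a (history c a)

history-recall : ∀ c a i → i < c → recall (history c a) c i ≡ truth i a
history-recall c a i i<c = trans (cong (lookupᴺ (history c a)) (monusP-correct c (suc i))) (go c i<c)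
  where
  go : ∀ c → i < c → lookupᴺ (history c a) (c ∸ suc i) ≡ truth i a
  go (suc c) (s≤s i≤c) with m≤n⇒m<n∨m≡n i≤c
  ... | inj₂ refl = begin
    lookupᴺ (history (suc i) a) (i ∸ i)        ≡⟨ cong₂ lookupᴺ (history-suc i a) (n∸n≡0 i) ⟩
    lookupᴺ (pair (truth i a) (history i a)) 0 ≡⟨ lookupᴺ-zero (truth i a) (history i a) ⟩
    truth i a                                  ∎
    where open ≡-Reasoning
  ... | inj₁ i<c = begin
    lookupᴺ (history (suc c) a) (c ∸ i)                        ≡⟨ cong₂ lookupᴺ (history-suc c a) (+-∸-assoc 1 i<c) ⟩
    lookupᴺ (pair (truth c a) (history c a)) (suc (c ∸ suc i)) ≡⟨ lookupᴺ-suc (truth c a) (history c a) (c ∸ suc i) ⟩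
    lookupᴺ (history c a) (c ∸ suc i)                          ≡⟨ go c i<c ⟩
    truth i a                                                  ∎
    where open ≡-Reasoning

truth-pair : ∀ t b a → truth (pair t b) a ≡ truthStep t b a (history (pair t b) a) (pair t b)
truth-pair t b a = trans (truth-unfold (pair t b) a)
  (cong₂ (λ t′ b′ → truthStep t′ b′ a (history (pair t b) a) (pair t b)) (unpair₁-pair t b) (unpair₂-pair t b))

module _ (a : ℕ) where
  recall-body : ∀ k b i → i ≤ b → recall (history (pair (suc k) b) a) (pair (suc k) b) i ≡ truth i a
  recall-body k b i i≤b = history-recall (pair (suc k) b) a i (≤-<-trans i≤b (<-pair-suc k b))

  recall-left : ∀ k x y → let c = pair (suc k) (pair x y) in recall (history c a) c (unpair₁ (pair x y)) ≡ truth x a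
  recall-left k x y = trans (cong (recall _ _) (unpair₁-pair x y)) (recall-body k (pair x y) x (≤-pairˡ x y))

  recall-right : ∀ k x y → let c = pair (suc k) (pair x y) in recall (history c a) c (unpair₂ (pair x y)) ≡ truth y a
  recall-right k x y = trans (cong (recall _ _) (unpair₂-pair x y)) (recall-body k (pair x y) y (≤-pairʳ x y))

Props : Signature
Props = record { funAr = λ _ → nothing ; relAr = λ _ → just 0 }

⌜_⌝ : Formula Props → ℕ
⌜_⌝ = code Props

ℕ[_] : ℕ → Structure Props
ℕ[ a ] = record { Dom = ℕ ; inhab = 0 ; funI = λ _ () ; relI = λ j _ _ → atom a j ≢ 0 }

truth-reflects : ∀ a ψ → QF Props ψ → truth ⌜ ψ ⌝ a reflects Sat Props ℕ[ a ] (valuation a) ψ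
truth-reflects a tt qf-tt = reflects-subst (truth-pair 0 0 a) (ofʸ tt)
truth-reflects a ff qf-ff = reflects-subst (truth-pair 1 0 a) (ofⁿ λ ())
truth-reflects a (var x ≐ var y) qf-eq =
  reflects-subst
    (trans (truth-pair 2 (pair (pair 0 x) (pair 0 y)) a)
           (cong₂ (λ u v → ⟦ eqP ⟧₂ (valuation a u) (valuation a v))
                  (trans (cong unpair₂ (unpair₁-pair (pair 0 x) (pair 0 y))) (unpair₂-pair 0 x))
                  (trans (cong unpair₂ (unpair₂-pair (pair 0 x) (pair 0 y))) (unpair₂-pair 0 y))))
    (eqP-reflects (valuation a x) (valuation a y))
truth-reflects a (var x ≐ app f () ts) qf-eq
truth-reflects a (app f () ts ≐ t) qf-eq
truth-reflects a (rel P refl []) qf-rel =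
  reflects-subst (trans (truth-pair 3 (pair P 0) a) (cong (⟦ nonZeroP ⟧₁ ∘ atom a) (unpair₁-pair P 0)))
                 (nonZeroP-reflects (atom a P))
truth-reflects a (~ φ) (qf-not qφ) =
  reflects-subst (trans (truth-pair 4 ⌜ φ ⌝ a) (cong (⟦ monusP ⟧₂ 1) (recall-body a 3 ⌜ φ ⌝ ⌜ φ ⌝ ≤-refl)))
                 (reflects-¬ (truth-reflects a φ qφ))
truth-reflects a (φ ∧' ψ) (qf-and qφ qψ) =
  reflects-subst (trans (truth-pair 5 _ a) (cong₂ ⟦ mulP ⟧₂ (recall-left a 4 ⌜ φ ⌝ ⌜ ψ ⌝) (recall-right a 4 ⌜ φ ⌝ ⌜ ψ ⌝)))
                 (reflects-× (truth-reflects a φ qφ) (truth-reflects a ψ qψ))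
truth-reflects a (φ ∨' ψ) (qf-or qφ qψ) =
  reflects-subst
    (trans (truth-pair 6 _ a) (cong ⟦ nonZeroP ⟧₁ (cong₂ ⟦ addP ⟧₂ (recall-left a 5 ⌜ φ ⌝ ⌜ ψ ⌝) (recall-right a 5 ⌜ φ ⌝ ⌜ ψ ⌝))))
    (reflects-⇔ (reflects⇒≢0⇔ (truth-reflects a φ qφ) ⊎-⇔ reflects⇒≢0⇔ (truth-reflects a ψ qψ))
                (nonZeroP-+-reflects (truth ⌜ φ ⌝ a) (truth ⌜ ψ ⌝ a)))
truth-reflects a (φ ⇒' ψ) (qf-imp qφ qψ) =
  reflects-subst
    (trans (truth-pair 7 _ a) (cong ⟦ isZeroP ⟧₁ (cong₂ ⟦ mulP ⟧₂ (recall-left a 6 ⌜ φ ⌝ ⌜ ψ ⌝)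
                                                                (cong (⟦ monusP ⟧₂ 1) (recall-right a 6 ⌜ φ ⌝ ⌜ ψ ⌝)))))
    (reflects-→ (truth-reflects a φ qφ) (truth-reflects a ψ qψ))

assignmentBound : ℕ → ℕ
assignmentBound n = pair (encodeList (λ _ → n) (suc n)) (encodeList (λ _ → 1) (suc n))

assignmentBoundP : PR 1
assignmentBoundP = comp₂ pairP (comp₂ replicateP (comp₁ succF (projF (# 0))) (projF (# 0)))
                               (comp₂ replicateP (comp₁ succF (projF (# 0))) (constP 1))

assignmentBoundP-correct : ∀ n → ⟦ assignmentBoundP ⟧₁ n ≡ assignmentBound n
assignmentBoundP-correct n rewrite replicateP-correct (suc n) n | replicateP-correct (suc n) 1 =
  pairP-correct (encodeList (λ _ → n) (suc n)) (encodeList (λ _ → 1) (suc n))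

decideP : PR 1
decideP = comp₂ (anyBelowP truthP) assignmentBoundP (projF (# 0))

opaque
  unfolding truthStepP

  decideP-minFree : T (isMinFree decideP)
  decideP-minFree = _

decideP-halts : ∀ n → decideP ⇓ n ∷ [] ⇒ ⟦ decideP ⟧₁ n
decideP-halts n = minFree-halts decideP decideP-minFree (n ∷ [])

decideP-reflects : ∀ n → ⟦ decideP ⟧₁ n reflects (Σ ℕ λ a → a ≤ assignmentBound n × truth n a ≢ 0)
decideP-reflects n = reflects-⇔
  (mk⇔ (λ (a , a≤ , t≢0) → a , subst (a ≤_) (assignmentBoundP-correct n) a≤ , t≢0 ∘ trans (truthP-correct n a))
       (λ (a , a≤ , t≢0) → a , subst (a ≤_) (sym (assignmentBoundP-correct n)) a≤ , t≢0 ∘ trans (sym (truthP-correct n a))))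
  (anyBelowP-reflects truthP (⟦ assignmentBoundP ⟧₁ n) n)

-- Normal assignments

bit : ∀ {A : Set} → Dec A → ℕ
bit (yes _) = 1
bit (no _)  = 0

bit-reflects : ∀ {A : Set} (d : Dec A) → bit d reflects A
bit-reflects (yes a) = ofʸ a
bit-reflects (no ¬a) = ofⁿ ¬a

reflects⇒≤1 : ∀ {A : Set} {v} → v reflects A → v ≤ 1
reflects⇒≤1 (ofʸ _) = ≤-refl
reflects⇒≤1 (ofⁿ _) = z≤n

Minimal : (ℕ → Set) → ℕ → Set
Minimal P k = P k × (∀ j → j < k → ¬ P j)

minimal-unique : ∀ {P k k′} → Minimal P k → Minimal P k′ → k ≡ k′
minimal-unique {k = k} {k′} (pk , k-min) (pk′ , k′-min) with <-cmp k k′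
... | tri< k<k′ _ _ = contradiction pk (k′-min k k<k′)
... | tri≈ _ k≡k′ _ = k≡k′
... | tri> _ _ k′<k = contradiction pk′ (k-min k′ k′<k)

minimal-below : ∀ {P} → Decidable P → ∀ n → P n → Σ ℕ λ k → k ≤ n × Minimal P k
minimal-below P? n pn with P? 0
... | yes p0 = 0 , z≤n , p0 , λ _ ()
minimal-below P? zero    p0 | no ¬p0 = contradiction p0 ¬p0
minimal-below P? (suc n) pn | no ¬p0 =
  let k , k≤n , pk , k-min = minimal-below (P? ∘ suc) n pn
  in suc k , s≤s k≤n , pk , λ { zero _ → ¬p0 ; (suc j) (s≤s j<k) → k-min j j<k }

module Normalise (em : ExcludedMiddle 0ℓ) (M : Structure Props) (σ : ℕ → Dom M) (n : ℕ) where

  private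
    least-sharing-value : ∀ x → Σ ℕ λ k → k ≤ x × Minimal (λ z → σ z ≡ σ x) k
    least-sharing-value x = minimal-below (λ z → em {σ z ≡ σ x}) x refl

  representative : ℕ → ℕ
  representative x = proj₁ (least-sharing-value x)

  representative-≤ : ∀ x → representative x ≤ x
  representative-≤ x = proj₁ (proj₂ (least-sharing-value x))

  representative-minimal : ∀ x → Minimal (λ z → σ z ≡ σ x) (representative x)
  representative-minimal x = proj₂ (proj₂ (least-sharing-value x))

  representative-≡ : ∀ x y → (σ x ≡ σ y) ⇔ (representative x ≡ representative y)
  representative-≡ x y = mk⇔
    (λ σx≡σy → let σr≡σy , y-min = representative-minimal y in
      minimal-unique (representative-minimal x)
                     (trans σr≡σy (sym σx≡σy) , λ j j<r σj≡σx → y-min j j<r (trans σj≡σx σx≡σy)))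
    (λ r≡r → trans (sym (proj₁ (representative-minimal x)))
                   (trans (cong σ r≡r) (proj₁ (representative-minimal y))))

  truthBit : ℕ → ℕ
  truthBit j = bit (em {relI M j refl []})

  private
    values bits : ℕ
    values = encodeList representative (suc n)
    bits   = encodeList truthBit (suc n)

  assignment : ℕ
  assignment = pair values bits

  assignment≤bound : assignment ≤ assignmentBound n
  assignment≤bound = pair-mono
    (encodeList-mono (suc n) λ x x≤n → ≤-trans (representative-≤ x) (≤-pred x≤n))
    (encodeList-mono (suc n) λ j _ → reflects⇒≤1 (bit-reflects (em {relI M j refl []})))

  valuation-assignment : ∀ x → x ≤ n → valuation assignment x ≡ representative x
  valuation-assignment x x≤n =
    trans (cong (λ ℓ → lookupᴺ ℓ x) (unpair₁-pair values bits)) (lookup-encodeList (suc n) representative x (s≤s x≤n))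

  atom-assignment : ∀ j → j ≤ n → atom assignment j ≡ truthBit j
  atom-assignment j j≤n =
    trans (cong (λ ℓ → lookupᴺ ℓ j) (unpair₂-pair values bits)) (lookup-encodeList (suc n) truthBit j (s≤s j≤n))

  private
    left≤ : ∀ k x y → pair k (pair x y) ≤ n → x ≤ n
    left≤ k x y ≤n = ≤-trans (≤-pairˡ x y) (≤-trans (≤-pairʳ k (pair x y)) ≤n)

    right≤ : ∀ k x y → pair k (pair x y) ≤ n → y ≤ n
    right≤ k x y ≤n = ≤-trans (≤-pairʳ x y) (≤-trans (≤-pairʳ k (pair x y)) ≤n)

  Sat-normalise : ∀ ψ → QF Props ψ → ⌜ ψ ⌝ ≤ n → Sat Props M σ ψ ⇔ Sat Props ℕ[ assignment ] (valuation assignment) ψ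
  Sat-normalise tt qf-tt _ = mk⇔ _ _
  Sat-normalise ff qf-ff _ = mk⇔ (λ ()) (λ ())
  Sat-normalise (var x ≐ var y) qf-eq ⌜ψ⌝≤n =
    subst₂ (λ u v → (σ x ≡ σ y) ⇔ (u ≡ v))
           (sym (valuation-assignment x (≤-trans (≤-pairʳ 0 x) (left≤ 2 (pair 0 x) (pair 0 y) ⌜ψ⌝≤n))))
           (sym (valuation-assignment y (≤-trans (≤-pairʳ 0 y) (right≤ 2 (pair 0 x) (pair 0 y) ⌜ψ⌝≤n))))
           (representative-≡ x y)
  Sat-normalise (var x ≐ app f () ts) qf-eq _
  Sat-normalise (app f () ts ≐ t) qf-eq _
  Sat-normalise (rel j refl []) qf-rel ⌜ψ⌝≤n =
    subst (λ v → relI M j refl [] ⇔ (v ≢ 0)) (sym (atom-assignment j (left≤ 3 j 0 ⌜ψ⌝≤n)))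
          (⇔-sym (reflects⇒≢0⇔ (bit-reflects (em {relI M j refl []}))))
  Sat-normalise (~ φ) (qf-not qφ) ⌜ψ⌝≤n = ¬-cong-⇔ (Sat-normalise φ qφ (≤-trans (≤-pairʳ 4 ⌜ φ ⌝) ⌜ψ⌝≤n))
  Sat-normalise (φ ∧' ψ) (qf-and qφ qψ) ⌜χ⌝≤n =
    Sat-normalise φ qφ (left≤ 5 ⌜ φ ⌝ ⌜ ψ ⌝ ⌜χ⌝≤n) ×-⇔ Sat-normalise ψ qψ (right≤ 5 ⌜ φ ⌝ ⌜ ψ ⌝ ⌜χ⌝≤n)
  Sat-normalise (φ ∨' ψ) (qf-or qφ qψ) ⌜χ⌝≤n =
    Sat-normalise φ qφ (left≤ 6 ⌜ φ ⌝ ⌜ ψ ⌝ ⌜χ⌝≤n) ⊎-⇔ Sat-normalise ψ qψ (right≤ 6 ⌜ φ ⌝ ⌜ ψ ⌝ ⌜χ⌝≤n)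
  Sat-normalise (φ ⇒' ψ) (qf-imp qφ qψ) ⌜χ⌝≤n =
    →-cong-⇔ (Sat-normalise φ qφ (left≤ 7 ⌜ φ ⌝ ⌜ ψ ⌝ ⌜χ⌝≤n)) (Sat-normalise ψ qψ (right≤ 7 ⌜ φ ⌝ ⌜ ψ ⌝ ⌜χ⌝≤n))

-- Cardinality sentences

module _ {S : Signature} (M : Structure S) where

  update-same : ∀ (σ : ℕ → Dom M) x d → update S M σ x d x ≡ d
  update-same σ x d with x ≟ x
  ... | yes _   = refl
  ... | no x≢x = contradiction refl x≢x

  update-other : ∀ (σ : ℕ → Dom M) x d y → x ≢ y → update S M σ x d y ≡ σ y
  update-other σ x d y x≢y with x ≟ y
  ... | yes x≡y = contradiction x≡y x≢y
  ... | no _    = refl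

module AtLeast (S : Signature) where

  differsFromFirst : ℕ → ℕ → Formula S
  differsFromFirst i zero    = tt
  differsFromFirst i (suc m) = (~ (var i ≐ var m)) ∧' differsFromFirst i m

  -- there are k elements x_i, …, x_{i+k-1}, distinct from each other and from x_0, …, x_{i-1}
  atLeast : ℕ → ℕ → Formula S
  atLeast i zero    = tt
  atLeast i (suc k) = ex i (differsFromFirst i i ∧' atLeast (suc i) k)

  free-differsFromFirst : ∀ {x} i m → Free S x (differsFromFirst i m) → x ≡ i ⊎ x < m
  free-differsFromFirst i (suc m) (f-andˡ (f-not (f-eqˡ o-var))) = inj₁ refl
  free-differsFromFirst i (suc m) (f-andˡ (f-not (f-eqʳ o-var))) = inj₂ ≤-refl
  free-differsFromFirst i (suc m) (f-andʳ x-free) with free-differsFromFirst i m x-free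
  ... | inj₁ x≡i = inj₁ x≡i
  ... | inj₂ x<m = inj₂ (m<n⇒m<1+n x<m)

  free-atLeast : ∀ {x} i k → Free S x (atLeast i k) → x < i
  free-atLeast i (suc k) (f-ex x≢i (f-andˡ x-free)) with free-differsFromFirst i i x-free
  ... | inj₁ x≡i = contradiction x≡i x≢i
  ... | inj₂ x<i = x<i
  free-atLeast i (suc k) (f-ex x≢i (f-andʳ x-free)) with m≤n⇒m<n∨m≡n (free-atLeast (suc i) k x-free)
  ... | inj₁ (s≤s x<i) = x<i
  ... | inj₂ x≡i       = contradiction (suc-injective x≡i) x≢i

  atLeast-sentence : ∀ k → Sentence S (atLeast 0 k)
  atLeast-sentence k x x-free with free-atLeast 0 k x-free
  ... | ()

  module _ (M : Structure S) where

    differsFromFirst-sat : ∀ (σ : ℕ → Dom M) i m → Sat S M σ (differsFromFirst i m) → ∀ j → j < m → σ i ≢ σ j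
    differsFromFirst-sat σ i (suc m) (σi≢σm , rest) j j<1+m with m≤n⇒m<n∨m≡n (≤-pred j<1+m)
    ... | inj₁ j<m  = differsFromFirst-sat σ i m rest j j<m
    ... | inj₂ refl = σi≢σm

    sat-differsFromFirst : ∀ (σ : ℕ → Dom M) i m → (∀ j → j < m → σ i ≢ σ j) → Sat S M σ (differsFromFirst i m)
    sat-differsFromFirst σ i zero    _  = tt
    sat-differsFromFirst σ i (suc m) σi≢ =
      σi≢ m ≤-refl , sat-differsFromFirst σ i m (λ j j<m → σi≢ j (m<n⇒m<1+n j<m))

    atLeast-distinct : ∀ (σ : ℕ → Dom M) i k → Sat S M σ (atLeast i k) →
      Σ (ℕ → Dom M) λ ρ → (∀ j → j < i → ρ j ≡ σ j) × (∀ j₁ j₂ → j₁ < j₂ → i ≤ j₂ → j₂ < i + k → ρ j₁ ≢ ρ j₂)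
    atLeast-distinct σ i zero _ =
      σ , (λ _ _ → refl) , λ _ j₂ _ i≤j₂ j₂<i+0 → contradiction (subst (j₂ <_) (+-identityʳ i) j₂<i+0) (≤⇒≯ i≤j₂)
    atLeast-distinct σ i (suc k) (d , σ′i-differs , rest) with atLeast-distinct (update S M σ i d) (suc i) k rest
    ... | ρ , ρ≡σ′ , ρ-distinct = ρ , ρ≡σ , distinct
      where
      σ′ : ℕ → Dom M
      σ′ = update S M σ i d
      ρ≡σ : ∀ j → j < i → ρ j ≡ σ j
      ρ≡σ j j<i = trans (ρ≡σ′ j (m<n⇒m<1+n j<i)) (update-other M σ i d j (λ i≡j → <-irrefl (sym i≡j) j<i))
      distinct : ∀ j₁ j₂ → j₁ < j₂ → i ≤ j₂ → j₂ < i + suc k → ρ j₁ ≢ ρ j₂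
      distinct j₁ j₂ j₁<j₂ i≤j₂ j₂<i+1+k with m≤n⇒m<n∨m≡n i≤j₂
      ... | inj₁ i<j₂ = ρ-distinct j₁ j₂ j₁<j₂ i<j₂ (subst (j₂ <_) (+-suc i k) j₂<i+1+k)
      ... | inj₂ refl = λ ρj₁≡ρi → differsFromFirst-sat σ′ i i σ′i-differs j₁ j₁<j₂
                          (trans (sym (ρ≡σ′ i ≤-refl)) (trans (sym ρj₁≡ρi) (ρ≡σ′ j₁ (m<n⇒m<1+n j₁<j₂))))

    atLeast-sat : (fresh : (ℕ → Dom M) → ℕ → Dom M) → (∀ σ i j → j < i → fresh σ i ≢ σ j) →
                  ∀ σ i k → Sat S M σ (atLeast i k)
    atLeast-sat fresh fresh≢ σ i zero    = tt
    atLeast-sat fresh fresh≢ σ i (suc k) =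
      fresh σ i , sat-differsFromFirst σ′ i i σ′i≢ , atLeast-sat fresh fresh≢ σ′ (suc i) k
      where
      σ′ : ℕ → Dom M
      σ′ = update S M σ i (fresh σ i)
      σ′i≢ : ∀ j → j < i → σ′ i ≢ σ′ j
      σ′i≢ j j<i rewrite update-same M σ i (fresh σ i)
                       | update-other M σ i (fresh σ i) j (λ i≡j → <-irrefl (sym i≡j) j<i) = fresh≢ σ i j j<i

sumBelow : (ℕ → ℕ) → ℕ → ℕ
sumBelow σ zero    = 0
sumBelow σ (suc i) = σ i + sumBelow σ i

≤-sumBelow : ∀ σ i j → j < i → σ j ≤ sumBelow σ i
≤-sumBelow σ (suc i) j j<1+i with m≤n⇒m<n∨m≡n (≤-pred j<1+i)
... | inj₂ refl = m≤m+n (σ j) (sumBelow σ j)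
... | inj₁ j<i  = ≤-trans (≤-sumBelow σ i j j<i) (m≤n+m (sumBelow σ i) (σ i))

suc-sumBelow-fresh : ∀ σ i j → j < i → suc (sumBelow σ i) ≢ σ j
suc-sumBelow-fresh σ i j j<i e = <-irrefl refl (≤-trans (≤-reflexive e) (≤-sumBelow σ i j j<i))

distinct-infinite : ∀ {S : Signature} {D : Set} →
  (∀ k → Σ (ℕ → D) λ ρ → ∀ j₁ j₂ → j₁ < j₂ → j₂ < k → ρ j₁ ≢ ρ j₂) → Infinite S D
distinct-infinite distinct (n , Fin↔D) =
  let ρ , ρ-distinct = distinct (suc n)
      i , j , i<j , e = pigeonhole (≤-refl {suc n}) (λ i → Inverse.from Fin↔D (ρ (toℕ i)))
      to∘from : ∀ d → Inverse.to Fin↔D (Inverse.from Fin↔D d) ≡ d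
      to∘from d = Inverse.inverseˡ Fin↔D refl
  in ρ-distinct (toℕ i) (toℕ j) i<j (toℕ<n j)
       (trans (sym (to∘from (ρ (toℕ i)))) (trans (cong (Inverse.to Fin↔D) e) (to∘from (ρ (toℕ j)))))

ℕ-infinite : ∀ {S : Signature} → Infinite S ℕ
ℕ-infinite {S} = distinct-infinite {S} (λ k → (λ x → x) , λ j₁ j₂ j₁<j₂ _ → <⇒≢ j₁<j₂)

atLeast-all⇒infinite : ∀ {S S′ : Signature} (M : Structure S) σ →
                       (∀ k → Sat S M σ (AtLeast.atLeast S 0 k)) → Infinite S′ (Dom M)
atLeast-all⇒infinite {S} {S′} M σ atLeast-k = distinct-infinite {S′} λ k →
  let ρ , _ , ρ-distinct = AtLeast.atLeast-distinct S M σ 0 k (atLeast-k k)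
  in ρ , λ j₁ j₂ j₁<j₂ j₂<k → ρ-distinct j₁ j₂ j₁<j₂ z≤n j₂<k

-- The theories T[ A ]

open AtLeast Props

Q : ℕ → Formula Props
Q m = rel m refl []

T[_] : (ℕ → Set) → Theory Props
T[ A ] = record
  { Ax       = λ ψ → Σ ℕ λ m → Σ ℕ λ k → A m × ψ ≡ (Q m ⇒' atLeast 0 k)
  ; sentence = λ { _ (m , k , _ , refl) x (f-impˡ (f-rel ()))
                 ; _ (m , k , _ , refl) x (f-impʳ x-free) → atLeast-sentence k x x-free } }

ℕ[_]-model : ∀ a A → Interp Props T[ A ]
ℕ[ a ]-model A = record
  { str    = ℕ[ a ]
  ; assign = valuation a
  ; models = λ { _ (m , k , _ , refl) _ →
                   atLeast-sat ℕ[ a ] (λ σ i → suc (sumBelow σ i)) suc-sumBelow-fresh (valuation a) 0 k } }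

module _ (em : ExcludedMiddle 0ℓ) (A : ℕ → Set) where

  normal-model : ∀ ψ → QF Props ψ → TSat Props T[ A ] ψ →
                 Σ ℕ λ a → a ≤ assignmentBound ⌜ ψ ⌝ × Sat Props ℕ[ a ] (valuation a) ψ
  normal-model ψ qψ (I , I⊨ψ) = assignment , assignment≤bound , Equivalence.to (Sat-normalise ψ qψ ≤-refl) I⊨ψ
    where open Normalise em (str I) (assign I) ⌜ ψ ⌝

  T[A]-sat⇔ : ∀ ψ → QF Props ψ →
              TSat Props T[ A ] ψ ⇔ (Σ ℕ λ a → a ≤ assignmentBound ⌜ ψ ⌝ × truth ⌜ ψ ⌝ a ≢ 0)
  T[A]-sat⇔ ψ qψ = mk⇔
    (λ sat → let a , a≤ , a⊨ψ = normal-model ψ qψ sat in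
             a , a≤ , Equivalence.from (reflects⇒≢0⇔ (truth-reflects a ψ qψ)) a⊨ψ)
    (λ (a , _ , t≢0) → ℕ[ a ]-model A , Equivalence.to (reflects⇒≢0⇔ (truth-reflects a ψ qψ)) t≢0)

  T[A]-decidable : DecidableTheory Props T[ A ]
  T[A]-decidable = decideP , λ ψ qψ →
    reflects-halting (decideP-halts ⌜ ψ ⌝) (reflects-⇔ (⇔-sym (T[A]-sat⇔ ψ qψ)) (decideP-reflects ⌜ ψ ⌝))

  T[A]-stablyInfinite : StablyInfinite Props T[ A ]
  T[A]-stablyInfinite ψ qψ sat =
    let a , _ , a⊨ψ = normal-model ψ qψ sat in ℕ[ a ]-model A , ℕ-infinite {Props} , a⊨ψ

-- Disjoint combinations

Indexed : ∀ {ℓ} → (ℕ → Set ℓ) → Maybe ℕ → Set ℓ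
Indexed C arity = ∀ {n} → arity ≡ just n → C n

FunInterp : Signature → Set → Set
FunInterp S D = ∀ f → Indexed (λ n → Vec D n → D) (funAr S f)

RelInterp : Signature → Set → Set₁
RelInterp S D = ∀ P → Indexed (λ n → Vec D n → Set) (relAr S P)

reinterpret : ∀ {S S′} (N : Structure S′) → FunInterp S (Dom N) → RelInterp S (Dom N) → Structure S
reinterpret N F R = record { Dom = Dom N ; inhab = inhab N ; funI = F ; relI = R }

module _ {ℓ} {C : ℕ → Set ℓ} where

  interleaveᴵ : ∀ f g → (∀ i → Indexed C (f i)) → (∀ i → Indexed C (g i)) → ∀ i → Indexed C (interleave f g i)
  interleaveᴵ f g u v zero          = u zero
  interleaveᴵ f g u v (suc zero)    = v zero
  interleaveᴵ f g u v (suc (suc i)) = interleaveᴵ (f ∘ suc) (g ∘ suc) (u ∘ suc) (v ∘ suc) i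

  interleaveᴵ-even : ∀ f g u v i {n} (p : f i ≡ just n) →
                     interleaveᴵ f g u v (dbl i) (trans (interleave-even f g i) p) ≡ u i p
  interleaveᴵ-even f g u v zero    p = refl
  interleaveᴵ-even f g u v (suc i) p = interleaveᴵ-even (f ∘ suc) (g ∘ suc) (u ∘ suc) (v ∘ suc) i p

  interleaveᴵ-odd : ∀ f g u v i {n} (p : g i ≡ just n) →
                    interleaveᴵ f g u v (suc (dbl i)) (trans (interleave-odd f g i) p) ≡ v i p
  interleaveᴵ-odd f g u v zero    p = refl
  interleaveᴵ-odd f g u v (suc i) p = interleaveᴵ-odd (f ∘ suc) (g ∘ suc) (u ∘ suc) (v ∘ suc) i p

module RenameSat (S S′ : Signature) (rf rr : ℕ → ℕ)
                 (okf : ∀ f → funAr S′ (rf f) ≡ funAr S f)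
                 (okr : ∀ P → relAr S′ (rr P) ≡ relAr S P) where

  open Rename S S′ rf rr okf okr public

  ren-QF : ∀ {φ} → QF S φ → QF S′ (ren φ)
  ren-QF qf-tt        = qf-tt
  ren-QF qf-ff        = qf-ff
  ren-QF qf-eq        = qf-eq
  ren-QF qf-rel       = qf-rel
  ren-QF (qf-not q)   = qf-not (ren-QF q)
  ren-QF (qf-and q r) = qf-and (ren-QF q) (ren-QF r)
  ren-QF (qf-or q r)  = qf-or (ren-QF q) (ren-QF r)
  ren-QF (qf-imp q r) = qf-imp (ren-QF q) (ren-QF r)

  module _ (N : Structure S′) (F : FunInterp S (Dom N)) (R : RelInterp S (Dom N))
           (funI-ren : ∀ f {n} (p : funAr S f ≡ just n) xs → funI N (rf f) (trans (okf f) p) xs ≡ F f p xs)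
           (relI-ren : ∀ P {n} (p : relAr S P ≡ just n) xs → relI N (rr P) (trans (okr P) p) xs ≡ R P p xs) where

    private
      M : Structure S
      M = reinterpret N F R

    mutual
      evalT-ren : ∀ {σ σ′} → (∀ x → σ x ≡ σ′ x) → ∀ t → evalT S′ N σ (renT t) ≡ evalT S M σ′ t
      evalT-ren σ≗σ′ (var x)      = σ≗σ′ x
      evalT-ren σ≗σ′ (app f p ts) = trans (cong (funI N (rf f) (trans (okf f) p)) (evalTs-ren σ≗σ′ ts)) (funI-ren f p _)

      evalTs-ren : ∀ {σ σ′} → (∀ x → σ x ≡ σ′ x) → ∀ {n} (ts : Vec (Term S) n) →
                   evalTs S′ N σ (renTs ts) ≡ evalTs S M σ′ ts
      evalTs-ren σ≗σ′ []       = refl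
      evalTs-ren σ≗σ′ (t ∷ ts) = cong₂ _∷_ (evalT-ren σ≗σ′ t) (evalTs-ren σ≗σ′ ts)

    update-ren : ∀ {σ σ′} → (∀ x → σ x ≡ σ′ x) → ∀ x d y → update S′ N σ x d y ≡ update S M σ′ x d y
    update-ren σ≗σ′ x d y with x ≟ y
    ... | yes _ = refl
    ... | no _  = σ≗σ′ y

    Sat-ren : ∀ φ {σ σ′} → (∀ x → σ x ≡ σ′ x) → Sat S′ N σ (ren φ) ⇔ Sat S M σ′ φ
    Sat-ren tt           _    = mk⇔ _ _
    Sat-ren ff           _    = mk⇔ (λ ()) (λ ())
    Sat-ren (s ≐ t)      σ≗σ′ = subst₂ (λ u v → (evalT S′ N _ (renT s) ≡ evalT S′ N _ (renT t)) ⇔ (u ≡ v))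
                                       (evalT-ren σ≗σ′ s) (evalT-ren σ≗σ′ t) (mk⇔ (λ e → e) (λ e → e))
    Sat-ren (rel P p ts) σ≗σ′ = subst (λ A → Sat S′ N _ (ren (rel P p ts)) ⇔ A)
                                      (trans (cong (relI N (rr P) (trans (okr P) p)) (evalTs-ren σ≗σ′ ts)) (relI-ren P p _))
                                      (mk⇔ (λ r → r) (λ r → r))
    Sat-ren (~ φ)        σ≗σ′ = ¬-cong-⇔ (Sat-ren φ σ≗σ′)
    Sat-ren (φ ∧' ψ)     σ≗σ′ = Sat-ren φ σ≗σ′ ×-⇔ Sat-ren ψ σ≗σ′
    Sat-ren (φ ∨' ψ)     σ≗σ′ = Sat-ren φ σ≗σ′ ⊎-⇔ Sat-ren ψ σ≗σ′
    Sat-ren (φ ⇒' ψ)     σ≗σ′ = →-cong-⇔ (Sat-ren φ σ≗σ′) (Sat-ren ψ σ≗σ′)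
    Sat-ren (all x φ)    σ≗σ′ = mk⇔ (λ h d → Equivalence.to (Sat-ren φ (update-ren σ≗σ′ x d)) (h d))
                                    (λ h d → Equivalence.from (Sat-ren φ (update-ren σ≗σ′ x d)) (h d))
    Sat-ren (ex x φ)     σ≗σ′ = mk⇔ (λ (d , s) → d , Equivalence.to (Sat-ren φ (update-ren σ≗σ′ x d)) s)
                                    (λ (d , s) → d , Equivalence.from (Sat-ren φ (update-ren σ≗σ′ x d)) s)

module Disjoint (S₁ S₂ : Signature) where

  module Ren₁ = RenameSat S₁ (S₁ ⊕ S₂) dbl dbl
                          (interleave-even (funAr S₁) (funAr S₂)) (interleave-even (relAr S₁) (relAr S₂))
  module Ren₂ = RenameSat S₂ (S₁ ⊕ S₂) (suc ∘ dbl) (suc ∘ dbl)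
                          (interleave-odd (funAr S₁) (funAr S₂)) (interleave-odd (relAr S₁) (relAr S₂))

  reduct₁ : Structure (S₁ ⊕ S₂) → Structure S₁
  reduct₁ N = reinterpret N (λ f p → funI N (dbl f) (trans (interleave-even (funAr S₁) (funAr S₂) f) p))
                            (λ P p → relI N (dbl P) (trans (interleave-even (relAr S₁) (relAr S₂) P) p))

  reduct₂ : Structure (S₁ ⊕ S₂) → Structure S₂
  reduct₂ N = reinterpret N (λ f p → funI N (suc (dbl f)) (trans (interleave-odd (funAr S₁) (funAr S₂) f) p))
                            (λ P p → relI N (suc (dbl P)) (trans (interleave-odd (relAr S₁) (relAr S₂) P) p))

  combine : (M : Structure S₁) → FunInterp S₂ (Dom M) → RelInterp S₂ (Dom M) → Structure (S₁ ⊕ S₂)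
  combine M F R = record
    { Dom = Dom M ; inhab = inhab M
    ; funI = interleaveᴵ (funAr S₁) (funAr S₂) (funI M) F
    ; relI = interleaveᴵ (relAr S₁) (relAr S₂) (relI M) R }

  reduct₁-Sat : ∀ N φ σ → Sat (S₁ ⊕ S₂) N σ (Ren₁.ren φ) ⇔ Sat S₁ (reduct₁ N) σ φ
  reduct₁-Sat N φ σ = Ren₁.Sat-ren N _ _ (λ _ _ _ → refl) (λ _ _ _ → refl) φ (λ _ → refl)

  reduct₂-Sat : ∀ N φ σ → Sat (S₁ ⊕ S₂) N σ (Ren₂.ren φ) ⇔ Sat S₂ (reduct₂ N) σ φ
  reduct₂-Sat N φ σ = Ren₂.Sat-ren N _ _ (λ _ _ _ → refl) (λ _ _ _ → refl) φ (λ _ → refl)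

  combine-Sat₁ : ∀ M F R φ σ → Sat (S₁ ⊕ S₂) (combine M F R) σ (Ren₁.ren φ) ⇔ Sat S₁ M σ φ
  combine-Sat₁ M F R φ σ = Ren₁.Sat-ren (combine M F R) (funI M) (relI M)
    (λ f p xs → cong (λ h → h xs) (interleaveᴵ-even (funAr S₁) (funAr S₂) (funI M) F f p))
    (λ P p xs → cong (λ h → h xs) (interleaveᴵ-even (relAr S₁) (relAr S₂) (relI M) R P p)) φ (λ _ → refl)

  combine-Sat₂ : ∀ M F R φ σ → Sat (S₁ ⊕ S₂) (combine M F R) σ (Ren₂.ren φ) ⇔ Sat S₂ (reinterpret M F R) σ φ
  combine-Sat₂ M F R φ σ = Ren₂.Sat-ren (combine M F R) F R
    (λ f p xs → cong (λ h → h xs) (interleaveᴵ-odd (funAr S₁) (funAr S₂) (funI M) F f p))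
    (λ P p xs → cong (λ h → h xs) (interleaveᴵ-odd (relAr S₁) (relAr S₂) (relI M) R P p)) φ (λ _ → refl)

  module _ {T₁ : Theory S₁} {T₂ : Theory S₂} where

    ⊔-reduct₁ : Interp (S₁ ⊕ S₂) (T₁ ⊔ T₂) → Interp S₁ T₁
    ⊔-reduct₁ I = record
      { str = reduct₁ (str I) ; assign = assign I
      ; models = λ φ ax → Equivalence.to (reduct₁-Sat (str I) φ (assign I))
                                          (models I (Ren₁.ren φ) (inj₁ (φ , ax , refl))) }

    ⊔-reduct₂ : Interp (S₁ ⊕ S₂) (T₁ ⊔ T₂) → Interp S₂ T₂
    ⊔-reduct₂ I = record
      { str = reduct₂ (str I) ; assign = assign I
      ; models = λ φ ax → Equivalence.to (reduct₂-Sat (str I) φ (assign I))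
                                          (models I (Ren₂.ren φ) (inj₂ (φ , ax , refl))) }

    ⊔-combine : (I : Interp S₁ T₁) (F : FunInterp S₂ (Dom (str I))) (R : RelInterp S₂ (Dom (str I))) →
                (∀ φ → Ax T₂ φ → Sat S₂ (reinterpret (str I) F R) (assign I) φ) → Interp (S₁ ⊕ S₂) (T₁ ⊔ T₂)
    ⊔-combine I F R models₂ = record
      { str = combine (str I) F R ; assign = assign I
      ; models = λ
          { _ (inj₁ (φ , ax , refl)) → Equivalence.from (combine-Sat₁ (str I) F R φ (assign I)) (models I φ ax)
          ; _ (inj₂ (φ , ax , refl)) → Equivalence.from (combine-Sat₂ (str I) F R φ (assign I)) (models₂ φ ax) } }

-- Codes of programs

mutual
  tag : ∀ {n} → PR n → ℕ
  tag zeroF       = 0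
  tag succF       = 1
  tag (projF _)   = 2
  tag (compF _ _) = 3
  tag (recF _ _)  = 4
  tag (minF _)    = 5

  body : ∀ {n} → PR n → ℕ
  body zeroF                = 0
  body succF                = 0
  body (projF i)            = toℕ i
  body (compF {m = m} f gs) = pair m (pair (encode f) (encode* gs))
  body (recF g h)           = pair (encode g) (encode h)
  body (minF f)             = encode f

  encode : ∀ {n} → PR n → ℕ
  encode f = pair (tag f) (body f)

  encode* : ∀ {n m} → Vec (PR n) m → ℕ
  encode* []       = 0
  encode* (g ∷ gs) = pair (encode g) (encode* gs)

mutual
  encode-injective : ∀ {n} {f f′ : PR n} → encode f ≡ encode f′ → f ≡ f′
  encode-injective {f = f} {f′} e = let t , b = pair-injective e in tag-body-injective f f′ t b

  encode*-injective : ∀ {n m} {gs gs′ : Vec (PR n) m} → encode* gs ≡ encode* gs′ → gs ≡ gs′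
  encode*-injective {gs = []}    {[]}      _ = refl
  encode*-injective {gs = _ ∷ _} {_ ∷ _}  e =
    let e₁ , e₂ = pair-injective e in cong₂ _∷_ (encode-injective e₁) (encode*-injective e₂)

  tag-body-injective : ∀ {n} (f f′ : PR n) → tag f ≡ tag f′ → body f ≡ body f′ → f ≡ f′
  tag-body-injective zeroF     zeroF      _ _ = refl
  tag-body-injective succF     succF      _ _ = refl
  tag-body-injective (projF i) (projF j)  _ b = cong projF (toℕ-injective b)
  tag-body-injective (compF {m = m} f gs) (compF {m = m′} f′ gs′) _ b
    with pair-injective {m} {pair (encode f) (encode* gs)} {m′} {pair (encode f′) (encode* gs′)} b
  ... | refl , b′ = let e₁ , e₂ = pair-injective b′ in cong₂ compF (encode-injective e₁) (encode*-injective e₂)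
  tag-body-injective (recF g h) (recF g′ h′) _ b =
    let e₁ , e₂ = pair-injective b in cong₂ recF (encode-injective e₁) (encode-injective e₂)
  tag-body-injective (minF f)   (minF f′)    _ b = cong minF (encode-injective b)
  tag-body-injective zeroF       succF       () _
  tag-body-injective zeroF       (projF _)   () _
  tag-body-injective zeroF       (compF _ _) () _
  tag-body-injective zeroF       (recF _ _)  () _
  tag-body-injective zeroF       (minF _)    () _
  tag-body-injective succF       zeroF       () _
  tag-body-injective succF       (projF _)   () _
  tag-body-injective succF       (compF _ _) () _
  tag-body-injective succF       (recF _ _)  () _
  tag-body-injective succF       (minF _)    () _
  tag-body-injective (projF _)   zeroF       () _
  tag-body-injective (projF _)   succF       () _
  tag-body-injective (projF _)   (compF _ _) () _
  tag-body-injective (projF _)   (recF _ _)  () _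
  tag-body-injective (projF _)   (minF _)    () _
  tag-body-injective (compF _ _) zeroF       () _
  tag-body-injective (compF _ _) succF       () _
  tag-body-injective (compF _ _) (projF _)   () _
  tag-body-injective (compF _ _) (recF _ _)  () _
  tag-body-injective (compF _ _) (minF _)    () _
  tag-body-injective (recF _ _)  zeroF       () _
  tag-body-injective (recF _ _)  succF       () _
  tag-body-injective (recF _ _)  (projF _)   () _
  tag-body-injective (recF _ _)  (compF _ _) () _
  tag-body-injective (recF _ _)  (minF _)    () _
  tag-body-injective (minF _)    zeroF       () _
  tag-body-injective (minF _)    succF       () _
  tag-body-injective (minF _)    (projF _)   () _
  tag-body-injective (minF _)    (compF _ _) () _
  tag-body-injective (minF _)    (recF _ _)  () _

-- The diagonal argument

HasInfiniteModel : (S : Signature) → Theory S → Formula S → Set₁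
HasInfiniteModel S T φ = Σ (Interp S T) λ I → Infinite S (Dom (str I)) × Sat S (str I) (assign I) φ

module _ {S : Signature} {T : Theory S} (φ : Formula S) where

  open Disjoint S Props

  φ∧Q : ℕ → Formula (S ⊕ Props)
  φ∧Q m = Ren₁.ren φ ∧' Ren₂.ren (Q m)

  φ∧Q-QF : QF S φ → ∀ m → QF (S ⊕ Props) (φ∧Q m)
  φ∧Q-QF qφ m = qf-and (Ren₁.ren-QF qφ) qf-rel

  φ∧Q-forces-infinity : ∀ {A m} → A m → TSat (S ⊕ Props) (T ⊔ T[ A ]) (φ∧Q m) → HasInfiniteModel S T φ
  φ∧Q-forces-infinity {A} {m} m∈A (I , I⊨φ , I⊨Q) =
    ⊔-reduct₁ {T₁ = T} {T[ A ]} I ,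
    atLeast-all⇒infinite {S′ = S} (str I₂) (assign I) atLeast-k ,
    Equivalence.to (reduct₁-Sat (str I) φ (assign I)) I⊨φ
    where
    I₂ : Interp Props T[ A ]
    I₂ = ⊔-reduct₂ {T₁ = T} {T[ A ]} I
    atLeast-k : ∀ k → Sat Props (str I₂) (assign I) (AtLeast.atLeast Props 0 k)
    atLeast-k k = models I₂ _ (m , k , m∈A , refl) (Equivalence.to (reduct₂-Sat (str I) (Q m) (assign I)) I⊨Q)

  φ∧Q-satisfiable : ∀ {A m} → ¬ A m → TSat S T φ → TSat (S ⊕ Props) (T ⊔ T[ A ]) (φ∧Q m)
  φ∧Q-satisfiable {A} {m} m∉A (I , I⊨φ) =
    ⊔-combine {T₁ = T} {T[ A ]} I (λ _ ()) Qᴵ models-T[A] ,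
    Equivalence.from (combine-Sat₁ (str I) (λ _ ()) Qᴵ φ (assign I)) I⊨φ ,
    Equivalence.from (combine-Sat₂ (str I) (λ _ ()) Qᴵ (Q m) (assign I)) refl
    where
    Qᴵ : RelInterp Props (Dom (str I))
    Qᴵ j _ _ = j ≡ m
    models-T[A] : ∀ χ → Ax T[ A ] χ → Sat Props (reinterpret (str I) (λ _ ()) Qᴵ) (assign I) χ
    models-T[A] _ (j , k , j∈A , refl) refl = contradiction j∈A m∉A

  SelfAccepting : ℕ → Set
  SelfAccepting m = Σ (PR 1) λ c → encode c ≡ m × c ⇓ code (S ⊕ Props) (φ∧Q m) ∷ [] ⇒ 1

  only-finite-models⇒undecidable-combination :
    QF S φ → TSat S T φ → ¬ HasInfiniteModel S T φ → ¬ DecidableTheory (S ⊕ Props) (T ⊔ T[ SelfAccepting ])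
  only-finite-models⇒undecidable-combination qφ φ-sat no-infinite-model (c , decides)
    with decides (φ∧Q (encode c)) (φ∧Q-QF qφ (encode c))
  ... | inj₁ (accepts , sat) = no-infinite-model (φ∧Q-forces-infinity (c , refl , accepts) sat)
  ... | inj₂ (rejects , unsat) = unsat (φ∧Q-satisfiable self-rejecting φ-sat)
    where
    self-rejecting : ¬ SelfAccepting (encode c)
    self-rejecting (c′ , c′≡c , c′-accepts) with encode-injective {f = c′} {c} c′≡c
    ... | refl with ⇓-deterministic c′-accepts rejects
    ... | ()

lowerEM : ExcludedMiddle (lsuc 0ℓ) → ExcludedMiddle 0ℓ
lowerEM em = map′ lower lift em

theorem4p7 : ExcludedMiddle (lsuc 0ℓ) →
    (S : Signature) (T : Theory S) →
    DecidableTheory S T →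
    ((S' : Signature) (T' : Theory S') →
       DecidableTheory S' T' → StablyInfinite S' T' →
       DecidableTheory (S ⊕ S') (T ⊔ T')) →
    StablyInfinite S T
theorem4p7 em S T _ combination-decidable φ qφ φ-sat with em {HasInfiniteModel S T φ}
... | yes infinite-model   = infinite-model
... | no no-infinite-model =
  contradiction
    (combination-decidable Props T[ A ] (T[A]-decidable (lowerEM em) A) (T[A]-stablyInfinite (lowerEM em) A))
    (only-finite-models⇒undecidable-combination φ qφ φ-sat no-infinite-model)
  where
  A : ℕ → Set
  A = SelfAccepting {T = T} φ
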